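{- Let $n\ge1$, $0\le k\le n$ and $w'\in\mathcal{W}^{(k)}_n$. (1) If $1$ is one of the $v$'s of $w'$, then the $w$ obtained from $w'$ by replacing the entry $1$ by $\overline{1}$ covers $w'$. (2) If for some $a$, $a-1$ is one of the $\lambda$'s of $w'$ (entry $\overline{a-1}$) and $a$ is one of the $v$'s of $w'$, then the $w$ obtained from $w'$ by replacing $\overline{a-1}$ by $\overline{a}$ and $a$ by $a-1$ covers $w'$. (3) If $b$ is one of the $u$'s of $w'$, $a$ is one of the $v$'s of $w'$, $a>b$, and all integers $b+1,\dots,a-1$ are among the $\lambda$'s of $w'$, then the $w$ obtained from $w'$ by swapping the entries $a$ and $b$ covers $w'$. (4) If $a$ is one of the $u$'s of $w'$, $b$ is one of the $\lambda$'s of $w'$ (entry $\overline b$), $a>b$, and all integers $b+1,\dots,a-1$ are among the $v$'s of $w'$, then the $w$ obtained from $w'$ by replacing $a$ by $b$ and $\overline{b}$ by $\overline{a}$ covers $w'$.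
   Context: $\mathcal{W}_n$ is the group of signed permutations of $\{ -n,\dots,n\}$ ($w(-i)=-w(i)$), written in one-line notation $w(1)\cdots w(n)$ with $\overline{a}=-a$; it is a Coxeter group generated by $s_0$ (sign change of the entry in position 1) and $s_i$, $1\le i\le n-1$ (swap of entries in positions $i,i+1$), with length $\ell$ and Bruhat order $\le$. $w$ covers $w'$ means $w'\le w$ and $\ell(w)=\ell(w')+1$. $\mathcal{W}^{(k)}_n$ is the set of $w\in\mathcal{W}_n$ whose one-line notation has the form $u_1\cdots u_k\,|\,\overline{\lambda_r}\cdots\overline{\lambda_1}\,v_1\cdots v_{n-k-r}$ for some $r\ge0$, with $0<u_1<\dots<u_k$, $0<\lambda_1<\dots<\lambda_r$, $0<v_1<\dots<v_{n-k-r}$; the $u_i$, $\lambda_i$, $v_i$ are called the $u$'s, $\lambda$'s, $v$'s. Replacements/swaps keep the positions of the entries. -}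

module Defs where

open import Data.Nat as ℕ using (ℕ; zero; suc; _+_)
open import Data.Fin using (Fin; toℕ; fromℕ<)
import Data.Fin as Fin
open import Data.Integer as ℤ using (ℤ; +_; -_; ∣_∣)
open import Data.Vec using (Vec; lookup; tabulate; toList; _[_]≔_)
open import Data.List as List using (List; []; _∷_; _++_; reverse; length; map; upTo)
open import Data.List.Relation.Binary.Permutation.Propositional using (_↭_)
open import Data.Product using (Σ; Σ-syntax; ∃; ∃-syntax; _×_)
open import Relation.Binary.PropositionalEquality using (_≡_)
open import Relation.Binary.Construct.Closure.ReflexiveTransitive using (Star)

-- Signed permutations of {-n..n}, in one-line notation w(1) ... w(n).
-- Position i (1-indexed, as in the paper) is index i-1 : Fin n.

OneLine : ℕ → Set
OneLine n = Vec ℤ n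

-- w is a signed permutation: the absolute values of its entries are a
-- permutation of 1,...,n (and w(-i) = -w(i) is implicit).
IsSignedPerm : ∀ {n} → OneLine n → Set
IsSignedPerm {n} w = map ∣_∣ (toList w) ↭ map suc (upTo n)

idW : ∀ n → OneLine n
idW n = tabulate (λ j → + suc (toℕ j))

swapPos : ∀ {n} → OneLine n → Fin n → Fin n → OneLine n
swapPos w p q = (w [ p ]≔ lookup w q) [ q ]≔ lookup w p

-- Coxeter generators of W_n.
--   s₀      : sign change of the entry in position 1
--   s i pf  : swap of the entries in (1-indexed) positions i+1, i+2,
--             i.e. the paper's generator s_{i+1}  (0 ≤ i, i+2 ≤ n)

data Gen : ℕ → Set where
  s₀ : ∀ {m} → Gen (suc m)
  s  : ∀ {n} (i : ℕ) → suc i ℕ.< n → Gen n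

-- right multiplication w ↦ w·g, acting on positions of the one-line notation
actGen : ∀ {n} → OneLine n → Gen n → OneLine n
actGen w s₀ = w [ Fin.zero ]≔ - lookup w Fin.zero
actGen w (s i pf) = swapPos w (fromℕ< (ℕ.<-trans (ℕ.n<1+n i) pf)) (fromℕ< pf)
  where import Data.Nat.Properties as ℕ

act : ∀ {n} → OneLine n → List (Gen n) → OneLine n
act w [] = w
act w (g ∷ gs) = act (actGen w g) gs

prod : ∀ {n} → List (Gen n) → OneLine n
prod {n} ws = act (idW n) ws

Length : ∀ {n} → OneLine n → ℕ → Set
Length {n} w m =
  (Σ[ ws ∈ List (Gen n) ] (length ws ≡ m × prod ws ≡ w)) ×
  (∀ (ws : List (Gen n)) → prod ws ≡ w → m ℕ.≤ length ws)

-- Reflections: conjugates u s u⁻¹ of simple generators.  Since generators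
-- are involutions, u⁻¹ is the reversed word; a reflection is thus given by
-- the word  u ++ s ∷ reverse u.
reflWord : ∀ {n} → List (Gen n) → Gen n → List (Gen n)
reflWord u g = u ++ g ∷ reverse u

BruhatStep : ∀ {n} → OneLine n → OneLine n → Set
BruhatStep {n} x y =
  (Σ[ u ∈ List (Gen n) ] Σ[ g ∈ Gen n ] y ≡ act x (reflWord u g)) ×
  (Σ[ m ∈ ℕ ] Σ[ m' ∈ ℕ ] (Length x m × Length y m' × m ℕ.< m'))

_≤B_ : ∀ {n} → OneLine n → OneLine n → Set
_≤B_ = Star BruhatStep

Covers : ∀ {n} → OneLine n → OneLine n → Set
Covers w w' = (w' ≤B w) × (Σ[ m ∈ ℕ ] (Length w' m × Length w (suc m)))

-- The shape  u₁⋯u_k | λ̄_r⋯λ̄₁ v₁⋯v_{n-k-r}  with the given k and r.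
-- Positions (0-indexed) 0..k-1 hold the u's, k..k+r-1 the λ̄'s,
-- k+r..n-1 the v's.

IsU : ∀ {n} (k r : ℕ) → Fin n → Set
IsU k r p = toℕ p ℕ.< k

IsLam : ∀ {n} (k r : ℕ) → Fin n → Set
IsLam k r p = (k ℕ.≤ toℕ p) × (toℕ p ℕ.< k + r)

IsV : ∀ {n} (k r : ℕ) → Fin n → Set
IsV k r p = k + r ℕ.≤ toℕ p

Shape : ∀ {n} (k r : ℕ) → OneLine n → Set
Shape {n} k r w =
  (k + r ℕ.≤ n) ×
  (∀ p → IsU k r p → + 0 ℤ.< lookup w p) ×
  (∀ p q → IsU k r p → IsU k r q → toℕ p ℕ.< toℕ q → lookup w p ℤ.< lookup w q) ×
  -- entries in positions k..k+r-1 are  -λ_r, …, -λ₁  with λ's positive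
  (∀ p → IsLam k r p → lookup w p ℤ.< + 0) ×
  -- λ_r > ⋯ > λ₁ means  -λ_r < ⋯ < -λ₁  from left to right
  (∀ p q → IsLam k r p → IsLam k r q → toℕ p ℕ.< toℕ q → lookup w p ℤ.< lookup w q) ×
  (∀ p → IsV k r p → + 0 ℤ.< lookup w p) ×
  (∀ p q → IsV k r p → IsV k r q → toℕ p ℕ.< toℕ q → lookup w p ℤ.< lookup w q)

InWk : ∀ n (k r : ℕ) → OneLine n → Set
InWk n k r w = IsSignedPerm w × Shape k r w

module Submission where

-- The Coxeter length of a signed permutation is identified with the
-- combinatorial statistic
--     invLength w = #{i : w(i) < 0} + Σ_{i<j} pairCost (w i) (w j),
--     pairCost x y = [x > y] + [x + y < 0],
-- and each of the four moves is realised as right multiplication by a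
-- reflection that raises invLength by exactly one; by definition of Covers
-- this is a cover.

open import Defs

module Development where
  open import Data.Nat using (ℕ; zero; suc; _+_; _∸_; _<_; _≤_; z≤n; s≤s; _≟_; _<?_)
  import Data.Nat.Properties as NP
  open import Data.Nat.Tactic.RingSolver using (solve-∀)
  open import Data.Fin as Fin using (Fin; toℕ; fromℕ<)
  open import Data.Fin.Properties using (toℕ-fromℕ<; toℕ<n)
  open import Data.Integer as ℤ using (ℤ; +_; -_; ∣_∣; -[1+_]; +<+)
  import Data.Integer.Properties as ZP
  open import Data.Vec using (Vec; []; _∷_; lookup; _[_]≔_; toList; tabulate)
  import Data.Vec.Properties as VP
  open import Data.List as L using (List; []; _∷_; _++_; reverse; length; [_]; map)
  import Data.List.Properties as LP
  open import Data.List.Relation.Unary.All as All using (All; []; _∷_)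
  open import Data.List.Relation.Unary.Any using (here; there)
  open import Data.List.Membership.Propositional using (_∈_)
  open import Data.List.Membership.Propositional.Properties using (∈-map⁻; ∈-upTo⁻)
  open import Data.List.Relation.Binary.Permutation.Propositional using (↭-sym; ↭⇒↭ₛ)
  open import Data.List.Relation.Binary.Permutation.Propositional.Properties using (∈-resp-↭)
  import Data.List.Relation.Binary.Permutation.Setoid.Properties as PermSetoid
  open import Data.List.Relation.Unary.Unique.Propositional using (Unique)
  open import Data.List.Relation.Unary.AllPairs using (_∷_)
  import Data.List.Relation.Unary.Unique.Propositional.Properties as UniqueP
  open import Data.Product using (Σ-syntax; _×_; _,_; proj₁; proj₂)
  open import Data.Sum using (_⊎_; inj₁; inj₂)
  open import Data.Empty using (⊥-elim)
  open import Relation.Nullary using (¬_; yes; no; Dec)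
  open import Relation.Binary.PropositionalEquality hiding ([_])
  open import Relation.Binary.Definitions using (tri<; tri≈; tri>)
  open import Relation.Binary.Construct.Closure.ReflexiveTransitive using (ε; _◅_)

  suc≢ : ∀ j → suc j ≢ j
  suc≢ j ()

  -- The entry of w in (0-indexed) position m; positions past the end read 0.
  -- Working with natural-number positions keeps the position arithmetic of
  -- reflection words out of Fin.
  at : ∀ {n} → Vec ℤ n → ℕ → ℤ
  at [] _ = + 0
  at (x ∷ xs) zero = x
  at (x ∷ xs) (suc m) = at xs m

  at-lookup : ∀ {n} (w : Vec ℤ n) (i : Fin n) → at w (toℕ i) ≡ lookup w i
  at-lookup (x ∷ w) Fin.zero = refl
  at-lookup (x ∷ w) (Fin.suc i) = at-lookup w i

  at-fromℕ< : ∀ {n} (w : Vec ℤ n) m (lt : m < n) → lookup w (fromℕ< lt) ≡ at w m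
  at-fromℕ< w m lt = trans (sym (at-lookup w (fromℕ< lt))) (cong (at w) (toℕ-fromℕ< lt))

  at-update-hit : ∀ {n} (w : Vec ℤ n) (i : Fin n) v → at (w [ i ]≔ v) (toℕ i) ≡ v
  at-update-hit (x ∷ w) Fin.zero v = refl
  at-update-hit (x ∷ w) (Fin.suc i) v = at-update-hit w i v

  at-update-miss : ∀ {n} (w : Vec ℤ n) (i : Fin n) v m → m ≢ toℕ i → at (w [ i ]≔ v) m ≡ at w m
  at-update-miss (x ∷ w) Fin.zero v zero ne = ⊥-elim (ne refl)
  at-update-miss (x ∷ w) Fin.zero v (suc m) ne = refl
  at-update-miss (x ∷ w) (Fin.suc i) v zero ne = refl
  at-update-miss (x ∷ w) (Fin.suc i) v (suc m) ne = at-update-miss w i v m (λ e → ne (cong suc e))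

  at-ext : ∀ {n} (v w : Vec ℤ n) → (∀ m → m < n → at v m ≡ at w m) → v ≡ w
  at-ext [] [] h = refl
  at-ext (x ∷ v) (y ∷ w) h = cong₂ _∷_ (h 0 (s≤s z≤n)) (at-ext v w (λ m lt → h (suc m) (s≤s lt)))

  update₂-self : ∀ {n} (w : Vec ℤ n) p q → (w [ p ]≔ lookup w p) [ q ]≔ lookup w q ≡ w
  update₂-self w p q = trans (cong (λ z → z [ q ]≔ lookup w q) (VP.[]≔-lookup w p)) (VP.[]≔-lookup w q)

  transp : ℕ → ℕ → ℕ → ℕ
  transp a b m with m ≟ b
  ... | yes _ = a
  ... | no _ with m ≟ a
  ... | yes _ = b
  ... | no _ = m

  transp-b : ∀ a b → transp a b b ≡ a
  transp-b a b with b ≟ b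
  ... | yes _ = refl
  ... | no ne = ⊥-elim (ne refl)

  transp-a : ∀ a b → transp a b a ≡ b
  transp-a a b with a ≟ b
  ... | yes e = e
  ... | no _ with a ≟ a
  ... | yes _ = refl
  ... | no ne = ⊥-elim (ne refl)

  transp-other : ∀ a b m → m ≢ a → m ≢ b → transp a b m ≡ m
  transp-other a b m na nb with m ≟ b
  ... | yes e = ⊥-elim (nb e)
  ... | no _ with m ≟ a
  ... | yes e = ⊥-elim (na e)
  ... | no _ = refl

  transp-involutive : ∀ a b m → transp a b (transp a b m) ≡ m
  transp-involutive a b m = go m (m ≟ a) (m ≟ b)
    where
    go : ∀ m → Dec (m ≡ a) → Dec (m ≡ b) → transp a b (transp a b m) ≡ m
    go m _ (yes refl) = trans (cong (transp a m) (transp-b a m)) (transp-a a m)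
    go m (yes refl) (no nb) = trans (cong (transp m b) (transp-a m b)) (transp-b m b)
    go m (no na) (no nb) = trans (cong (transp a b) (transp-other a b m na nb)) (transp-other a b m na nb)

  transp-sym : ∀ a b m → transp a b m ≡ transp b a m
  transp-sym a b m = go m (m ≟ a) (m ≟ b)
    where
    go : ∀ m → Dec (m ≡ a) → Dec (m ≡ b) → transp a b m ≡ transp b a m
    go m (yes refl) (yes refl) = refl
    go m (yes refl) (no nb) = trans (transp-a m b) (sym (transp-b b m))
    go m (no na) (yes refl) = trans (transp-b a m) (sym (transp-a m a))
    go m (no na) (no nb) = trans (transp-other a b m na nb) (sym (transp-other b a m nb na))

  transp-< : ∀ {n} a b m → a < n → b < n → m < n → transp a b m < n
  transp-< {n} a b m la lb lm = go m lm (m ≟ a) (m ≟ b)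
    where
    go : ∀ m → m < n → Dec (m ≡ a) → Dec (m ≡ b) → transp a b m < n
    go m _ _ (yes refl) = subst (_< n) (sym (transp-b a m)) la
    go m _ (yes refl) (no nb) = subst (_< n) (sym (transp-a m b)) lb
    go m lm (no na) (no nb) = subst (_< n) (sym (transp-other a b m na nb)) lm

  transp-conj : ∀ i j m → suc i < j → transp i (suc i) (transp (suc i) j (transp i (suc i) m)) ≡ transp i j m
  transp-conj i j m lt = go m (m ≟ i) (m ≟ suc i) (m ≟ j)
    where
    i≢j : i ≢ j
    i≢j = NP.<⇒≢ (NP.<-trans (NP.n<1+n i) lt)
    si≢j : suc i ≢ j
    si≢j = NP.<⇒≢ lt
    go : ∀ m → Dec (m ≡ i) → Dec (m ≡ suc i) → Dec (m ≡ j) →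
         transp i (suc i) (transp (suc i) j (transp i (suc i) m)) ≡ transp i j m
    go m (yes refl) _ _ = begin
      transp m (suc m) (transp (suc m) j (transp m (suc m) m)) ≡⟨ cong (λ z → transp m (suc m) (transp (suc m) j z)) (transp-a m (suc m)) ⟩
      transp m (suc m) (transp (suc m) j (suc m))             ≡⟨ cong (transp m (suc m)) (transp-a (suc m) j) ⟩
      transp m (suc m) j                                       ≡⟨ transp-other m (suc m) j (≢-sym i≢j) (≢-sym si≢j) ⟩
      j                                                        ≡⟨ sym (transp-a m j) ⟩
      transp m j m                                             ∎
      where open ≡-Reasoning
    go m (no ni) (yes refl) _ = begin
      transp i (suc i) (transp (suc i) j (transp i (suc i) (suc i))) ≡⟨ cong (λ z → transp i (suc i) (transp (suc i) j z)) (transp-b i (suc i)) ⟩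
      transp i (suc i) (transp (suc i) j i)                         ≡⟨ cong (transp i (suc i)) (transp-other (suc i) j i (≢-sym (suc≢ i)) i≢j) ⟩
      transp i (suc i) i                                            ≡⟨ transp-a i (suc i) ⟩
      suc i                                                         ≡⟨ sym (transp-other i j (suc i) (suc≢ i) si≢j) ⟩
      transp i j (suc i)                                            ∎
      where open ≡-Reasoning
    go m (no ni) (no nsi) (yes refl) = begin
      transp i (suc i) (transp (suc i) m (transp i (suc i) m)) ≡⟨ cong (λ z → transp i (suc i) (transp (suc i) m z)) (transp-other i (suc i) m ni nsi) ⟩
      transp i (suc i) (transp (suc i) m m)                   ≡⟨ cong (transp i (suc i)) (transp-b (suc i) m) ⟩
      transp i (suc i) (suc i)                                ≡⟨ transp-b i (suc i) ⟩
      i                                                       ≡⟨ sym (transp-b i m) ⟩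
      transp i m m                                            ∎
      where open ≡-Reasoning
    go m (no ni) (no nsi) (no nj) = begin
      transp i (suc i) (transp (suc i) j (transp i (suc i) m)) ≡⟨ cong (λ z → transp i (suc i) (transp (suc i) j z)) (transp-other i (suc i) m ni nsi) ⟩
      transp i (suc i) (transp (suc i) j m)                   ≡⟨ cong (transp i (suc i)) (transp-other (suc i) j m nsi nj) ⟩
      transp i (suc i) m                                      ≡⟨ transp-other i (suc i) m ni nsi ⟩
      m                                                       ≡⟨ sym (transp-other i j m ni nj) ⟩
      transp i j m                                            ∎
      where open ≡-Reasoning

  at-swapPos : ∀ {n} (w : Vec ℤ n) (p q : Fin n) m → at (swapPos w p q) m ≡ at w (transp (toℕ p) (toℕ q) m)
  at-swapPos w p q m with m ≟ toℕ q
  ... | yes refl = trans (at-update-hit (w [ p ]≔ lookup w q) q (lookup w p)) (sym (at-lookup w p))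
  ... | no nq with m ≟ toℕ p
  ... | yes refl = trans (at-update-miss (w [ p ]≔ lookup w q) q (lookup w p) _ nq)
                         (trans (at-update-hit w p _) (sym (at-lookup w q)))
  ... | no np = trans (at-update-miss (w [ p ]≔ lookup w q) q (lookup w p) _ nq) (at-update-miss w p (lookup w q) _ np)

  swapPos-sym : ∀ {n} (w : Vec ℤ n) p q → swapPos w q p ≡ swapPos w p q
  swapPos-sym w p q = at-ext _ _ λ m _ →
    trans (at-swapPos w q p m) (trans (cong (at w) (transp-sym (toℕ q) (toℕ p) m)) (sym (at-swapPos w p q m)))

  negateAt : ℕ → (ℕ → ℤ) → ℕ → ℤ
  negateAt j f m with m ≟ j
  ... | yes _ = - f m
  ... | no _ = f m

  negateAt-hit : ∀ j f → negateAt j f j ≡ - f j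
  negateAt-hit j f with j ≟ j
  ... | yes _ = refl
  ... | no ne = ⊥-elim (ne refl)

  negateAt-miss : ∀ j f m → m ≢ j → negateAt j f m ≡ f m
  negateAt-miss j f m ne with m ≟ j
  ... | yes e = ⊥-elim (ne e)
  ... | no _ = refl

  ∣negateAt∣ : ∀ j f m → ∣ negateAt j f m ∣ ≡ ∣ f m ∣
  ∣negateAt∣ j f m with m ≟ j
  ... | yes _ = ZP.∣-i∣≡∣i∣ (f m)
  ... | no _ = refl

  at-s₀ : ∀ {n} (w : Vec ℤ (suc n)) m → at (actGen w s₀) m ≡ negateAt 0 (at w) m
  at-s₀ (x ∷ w) zero = refl
  at-s₀ (x ∷ w) (suc m) = refl

  at-s : ∀ {n} (w : Vec ℤ n) i (pf : suc i < n) m → at (actGen w (s i pf)) m ≡ at w (transp i (suc i) m)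
  at-s w i pf m = trans (at-swapPos w _ _ m)
    (cong (λ z → at w z) (cong₂ (λ a b → transp a b m) (toℕ-fromℕ< _) (toℕ-fromℕ< pf)))

  actGen-involutive : ∀ {n} (w : Vec ℤ n) g → actGen (actGen w g) g ≡ w
  actGen-involutive {suc n} w s₀ = at-ext _ _ λ m _ → trans (at-s₀ (actGen w s₀) m) (go m (m ≟ 0))
    where
    go : ∀ m → Dec (m ≡ 0) → negateAt 0 (at (actGen w s₀)) m ≡ at w m
    go m (yes refl) = trans (negateAt-hit 0 (at (actGen w s₀)))
      (trans (cong -_ (at-s₀ w 0)) (trans (cong -_ (negateAt-hit 0 (at w))) (ZP.neg-involutive (at w 0))))
    go m (no ne) = trans (negateAt-miss 0 (at (actGen w s₀)) m ne) (trans (at-s₀ w m) (negateAt-miss 0 (at w) m ne))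
  actGen-involutive w (s i pf) = at-ext _ _ λ m _ →
    trans (at-s (actGen w (s i pf)) i pf m) (trans (at-s w i pf _) (cong (at w) (transp-involutive i (suc i) m)))

  act-++ : ∀ {n} (w : Vec ℤ n) xs ys → act w (xs ++ ys) ≡ act (act w xs) ys
  act-++ w [] ys = refl
  act-++ w (x ∷ xs) ys = act-++ (actGen w x) xs ys

  act-reflWord-∷ : ∀ {n} (w : Vec ℤ n) x u g →
    act w (reflWord (x ∷ u) g) ≡ actGen (act (actGen w x) (reflWord u g)) x
  act-reflWord-∷ w x u g =
    trans (cong (λ z → act (actGen w x) (u ++ g ∷ z)) (LP.unfold-reverse x u))
    (trans (cong (act (actGen w x)) (sym (LP.++-assoc u (g ∷ reverse u) [ x ])))
     (act-++ (actGen w x) (u ++ g ∷ reverse u) [ x ]))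

  reverse-reflWord : ∀ {n} (u : List (Gen n)) g → reverse (reflWord u g) ≡ reflWord u g
  reverse-reflWord u g =
    trans (LP.reverse-++ u (g ∷ reverse u))
    (trans (cong (_++ reverse u) (trans (LP.unfold-reverse g (reverse u))
                                   (cong (L._∷ʳ g) (LP.reverse-involutive u))))
    (LP.++-assoc u [ g ] (reverse u)))

  act-reflWord-++ : ∀ {n} (w : Vec ℤ n) A V g →
    act w (reflWord (A ++ V) g) ≡ act (act (act w A) (reflWord V g)) (reverse A)
  act-reflWord-++ w A V g =
    trans (act-++ w (A ++ V) (g ∷ reverse (A ++ V)))
    (trans (cong (act (act w (A ++ V))) (cong (g ∷_) (LP.reverse-++ A V)))
    (trans (cong (λ z → act z (g ∷ reverse V ++ reverse A)) (act-++ w A V))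
    (trans (act-++ (act (act w A) V) (g ∷ reverse V) (reverse A))
    (cong (λ z → act z (reverse A)) (sym (act-++ (act w A) V (g ∷ reverse V)))))))

  -- Sign-change reflection at position j:  s_j ⋯ s_1 s₀ s_1 ⋯ s_j  (generator s i = s_{i+1}).
  negateWord : ∀ {n} j → j < suc n → List (Gen (suc n))
  negateWord zero _ = []
  negateWord (suc j) lt = s j lt ∷ negateWord j (NP.<-trans (NP.n<1+n j) lt)

  act-negateWord : ∀ {n} j lt (w : Vec ℤ (suc n)) m →
    at (act w (reflWord (negateWord j lt) s₀)) m ≡ negateAt j (at w) m
  act-negateWord zero lt w m = at-s₀ w m
  act-negateWord {n} (suc j) lt w m =
    trans (cong (λ z → at z m) (act-reflWord-∷ w (s j lt) (negateWord j _) s₀))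
    (trans (at-s (act w′ (reflWord (negateWord j lt′) s₀)) j lt m)
    (trans (act-negateWord j lt′ w′ (transp j (suc j) m))
     (conjugate m (m ≟ suc j) (m ≟ j))))
    where
    lt′ : j < suc n
    lt′ = NP.<-trans (NP.n<1+n j) lt
    w′ : Vec ℤ (suc n)
    w′ = actGen w (s j lt)
    -- negating position j of w s_{j+1} is negating position j+1 of w, then swapping
    conjugate : ∀ m → Dec (m ≡ suc j) → Dec (m ≡ j) →
      negateAt j (at w′) (transp j (suc j) m) ≡ negateAt (suc j) (at w) m
    conjugate m (yes refl) _ = begin
      negateAt j (at w′) (transp j (suc j) (suc j)) ≡⟨ cong (negateAt j (at w′)) (transp-b j (suc j)) ⟩
      negateAt j (at w′) j                          ≡⟨ negateAt-hit j (at w′) ⟩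
      - at w′ j                                     ≡⟨ cong -_ (at-s w j lt j) ⟩
      - at w (transp j (suc j) j)                   ≡⟨ cong (λ z → - at w z) (transp-a j (suc j)) ⟩
      - at w (suc j)                                ≡⟨ sym (negateAt-hit (suc j) (at w)) ⟩
      negateAt (suc j) (at w) (suc j)               ∎
      where open ≡-Reasoning
    conjugate m (no nsj) (yes refl) = begin
      negateAt m (at w′) (transp m (suc m) m) ≡⟨ cong (negateAt m (at w′)) (transp-a m (suc m)) ⟩
      negateAt m (at w′) (suc m)              ≡⟨ negateAt-miss m (at w′) (suc m) (suc≢ m) ⟩
      at w′ (suc m)                           ≡⟨ at-s w m lt (suc m) ⟩
      at w (transp m (suc m) (suc m))         ≡⟨ cong (at w) (transp-b m (suc m)) ⟩
      at w m                                  ≡⟨ sym (negateAt-miss (suc m) (at w) m nsj) ⟩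
      negateAt (suc m) (at w) m               ∎
      where open ≡-Reasoning
    conjugate m (no nsj) (no nj) = begin
      negateAt j (at w′) (transp j (suc j) m) ≡⟨ cong (negateAt j (at w′)) (transp-other j (suc j) m nj nsj) ⟩
      negateAt j (at w′) m                    ≡⟨ negateAt-miss j (at w′) m nj ⟩
      at w′ m                                 ≡⟨ at-s w j lt m ⟩
      at w (transp j (suc j) m)               ≡⟨ cong (at w) (transp-other j (suc j) m nj nsj) ⟩
      at w m                                  ≡⟨ sym (negateAt-miss (suc j) (at w) m nsj) ⟩
      negateAt (suc j) (at w) m               ∎
      where open ≡-Reasoning

  negateWordAt : ∀ {n} (P : Fin (suc n)) → List (Gen (suc n))
  negateWordAt P = negateWord (toℕ P) (toℕ<n P)

  act-negateWordAt : ∀ {n} (w : Vec ℤ (suc n)) (P : Fin (suc n)) →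
    act w (reflWord (negateWordAt P) s₀) ≡ w [ P ]≔ - lookup w P
  act-negateWordAt w P = at-ext _ _ λ m _ → trans (act-negateWord (toℕ P) (toℕ<n P) w m) (go m (m ≟ toℕ P))
    where
    go : ∀ m → Dec (m ≡ toℕ P) → negateAt (toℕ P) (at w) m ≡ at (w [ P ]≔ - lookup w P) m
    go m (yes refl) = trans (negateAt-hit (toℕ P) (at w))
      (trans (cong -_ (at-lookup w P)) (sym (at-update-hit w P _)))
    go m (no ne) = trans (negateAt-miss (toℕ P) (at w) m ne) (sym (at-update-miss w P _ m ne))

  -- Transposition reflection of positions i and i+1+d:
  -- s_{i+1} ⋯ s_{i+d} · s_{i+d+1} · s_{i+d} ⋯ s_{i+1}.
  transpWord : ∀ {n} i d → suc (i + d) < n → List (Gen n)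
  transpGen : ∀ {n} i d → suc (i + d) < n → Gen n

  transpWord-<₁ : ∀ {n} i d → suc (i + suc d) < n → suc i < n
  transpWord-<₁ i d lt = NP.<-≤-trans (s≤s (s≤s (NP.m≤m+n i (suc d)))) lt

  transpWord-<₂ : ∀ {n} i d → suc (i + suc d) < n → suc (suc i + d) < n
  transpWord-<₂ {n} i d lt = subst (λ z → suc z < n) (NP.+-suc i d) lt

  transpWord i zero lt = []
  transpWord i (suc d) lt = s i (transpWord-<₁ i d lt) ∷ transpWord (suc i) d (transpWord-<₂ i d lt)

  transpGen {n} i zero lt = s i (subst (λ z → suc z < n) (NP.+-identityʳ i) lt)
  transpGen i (suc d) lt = transpGen (suc i) d (transpWord-<₂ i d lt)

  act-transpWord : ∀ {n} i d lt (w : Vec ℤ n) m →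
    at (act w (reflWord (transpWord i d lt) (transpGen i d lt))) m ≡ at w (transp i (suc (i + d)) m)
  act-transpWord {n} i zero lt w m =
    trans (at-s w i (subst (λ z → suc z < n) (NP.+-identityʳ i) lt) m)
          (cong (λ z → at w (transp i (suc z) m)) (sym (NP.+-identityʳ i)))
  act-transpWord {n} i (suc d) lt w m =
    trans (cong (λ z → at z m) (act-reflWord-∷ w (s i lt₁) (transpWord (suc i) d lt₂) _))
    (trans (at-s (act w′ (reflWord (transpWord (suc i) d lt₂) (transpGen (suc i) d lt₂))) i lt₁ m)
    (trans (act-transpWord (suc i) d lt₂ w′ (transp i (suc i) m))
    (trans (at-s w i lt₁ _)
    (cong (at w) (trans (transp-conj i (suc (suc i + d)) m (s≤s (s≤s (NP.m≤m+n i d))))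
      (cong (λ z → transp i (suc z) m) (sym (NP.+-suc i d))))))))
    where
    lt₁ : suc i < n
    lt₁ = transpWord-<₁ i d lt
    lt₂ : suc (suc i + d) < n
    lt₂ = transpWord-<₂ i d lt
    w′ : Vec ℤ n
    w′ = actGen w (s i lt₁)

  gap : ∀ {n} (P Q : Fin n) → ℕ
  gap P Q = toℕ Q ∸ suc (toℕ P)

  gap-eq : ∀ {n} (P Q : Fin n) → toℕ P < toℕ Q → toℕ Q ≡ suc (toℕ P + gap P Q)
  gap-eq P Q lt = sym (NP.m+[n∸m]≡n lt)

  transpWordAt : ∀ {n} (P Q : Fin n) → toℕ P < toℕ Q → List (Gen n)
  transpWordAt {n} P Q lt = transpWord (toℕ P) (gap P Q) (subst (_< n) (gap-eq P Q lt) (toℕ<n Q))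

  transpGenAt : ∀ {n} (P Q : Fin n) → toℕ P < toℕ Q → Gen n
  transpGenAt {n} P Q lt = transpGen (toℕ P) (gap P Q) (subst (_< n) (gap-eq P Q lt) (toℕ<n Q))

  act-transpWordAt : ∀ {n} (w : Vec ℤ n) (P Q : Fin n) (lt : toℕ P < toℕ Q) →
    act w (reflWord (transpWordAt P Q lt) (transpGenAt P Q lt)) ≡ swapPos w P Q
  act-transpWordAt {n} w P Q lt = at-ext _ _ λ m _ →
    trans (act-transpWord (toℕ P) (gap P Q) _ w m)
    (trans (cong (λ z → at w (transp (toℕ P) z m)) (sym (gap-eq P Q lt))) (sym (at-swapPos w P Q m)))

  -- Signed transposition of positions P < Q: conjugate the transposition by
  -- the sign change at P.
  signedTranspWordAt : ∀ {n} (P Q : Fin (suc n)) → toℕ P < toℕ Q → List (Gen (suc n))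
  signedTranspWordAt P Q lt = reflWord (negateWordAt P) s₀ ++ transpWordAt P Q lt

  act-signedTranspWordAt : ∀ {n} (w : Vec ℤ (suc n)) (P Q : Fin (suc n)) (lt : toℕ P < toℕ Q) →
    act w (reflWord (signedTranspWordAt P Q lt) (transpGenAt P Q lt)) ≡ (w [ P ]≔ - lookup w Q) [ Q ]≔ - lookup w P
  act-signedTranspWordAt {n} w P Q lt = begin
    act w (reflWord (N ++ T) g)                      ≡⟨ act-reflWord-++ w N T g ⟩
    act (act (act w N) (reflWord T g)) (reverse N)   ≡⟨ cong (act (act (act w N) (reflWord T g))) (reverse-reflWord (negateWordAt P) s₀) ⟩
    act (act (act w N) (reflWord T g)) N             ≡⟨ cong (λ z → act (act z (reflWord T g)) N) (act-negateWordAt w P) ⟩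
    act (act w₁ (reflWord T g)) N                    ≡⟨ cong (λ z → act z N) (act-transpWordAt w₁ P Q lt) ⟩
    act w₂ N                                         ≡⟨ act-negateWordAt w₂ P ⟩
    w₂ [ P ]≔ - lookup w₂ P                          ≡⟨ at-ext _ _ (λ m _ → pointwise m (m ≟ toℕ P) (m ≟ toℕ Q)) ⟩
    (w [ P ]≔ - lookup w Q) [ Q ]≔ - lookup w P      ∎
    where
    open ≡-Reasoning
    N T : List (Gen (suc n))
    N = reflWord (negateWordAt P) s₀
    T = transpWordAt P Q lt
    g : Gen (suc n)
    g = transpGenAt P Q lt
    w₁ w₂ t₁ : Vec ℤ (suc n)
    w₁ = w [ P ]≔ - lookup w P
    w₂ = swapPos w₁ P Q
    t₁ = w [ P ]≔ - lookup w Q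
    P≢Q : toℕ P ≢ toℕ Q
    P≢Q = NP.<⇒≢ lt
    pointwise : ∀ m → Dec (m ≡ toℕ P) → Dec (m ≡ toℕ Q) → at (w₂ [ P ]≔ - lookup w₂ P) m ≡ at (t₁ [ Q ]≔ - lookup w P) m
    pointwise m (yes refl) _ =
      trans (at-update-hit w₂ P (- lookup w₂ P))
      (trans (cong -_ (trans (sym (at-lookup w₂ P)) (trans (at-swapPos w₁ P Q (toℕ P))
        (trans (cong (at w₁) (transp-a (toℕ P) (toℕ Q)))
        (trans (at-update-miss w P (- lookup w P) (toℕ Q) (≢-sym P≢Q)) (at-lookup w Q))))))
      (sym (trans (at-update-miss t₁ Q (- lookup w P) (toℕ P) P≢Q) (at-update-hit w P (- lookup w Q)))))
    pointwise m (no nP) (yes refl) =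
      trans (at-update-miss w₂ P (- lookup w₂ P) m nP) (trans (at-swapPos w₁ P Q m)
      (trans (cong (at w₁) (transp-b (toℕ P) (toℕ Q)))
      (trans (at-update-hit w P (- lookup w P)) (sym (at-update-hit t₁ Q (- lookup w P))))))
    pointwise m (no nP) (no nQ) =
      trans (at-update-miss w₂ P (- lookup w₂ P) m nP) (trans (at-swapPos w₁ P Q m)
      (trans (cong (at w₁) (transp-other (toℕ P) (toℕ Q) m nP nQ))
      (trans (at-update-miss w P (- lookup w P) m nP)
      (sym (trans (at-update-miss t₁ Q (- lookup w P) m nQ) (at-update-miss w P (- lookup w Q) m nP))))))

  isNeg : ℤ → ℕ
  isNeg (+ _) = 0
  isNeg -[1+ _ ] = 1

  -- pairCost x y = [x > y] + [x + y < 0] for an entry x standing left of an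
  -- entry y with ∣x∣ ≠ ∣y∣: one if ∣y∣ < ∣x∣, and 2·[y < 0] otherwise.
  -- It depends on x only through ∣x∣.
  pairCostAbs : ℕ → ℤ → ℕ
  pairCostAbs ax y with ∣ y ∣ <? ax
  ... | yes _ = 1
  ... | no _ = isNeg y + isNeg y

  pairCost : ℤ → ℤ → ℕ
  pairCost x y = pairCostAbs ∣ x ∣ y

  pairCost-< : ∀ x y → ∣ y ∣ < ∣ x ∣ → pairCost x y ≡ 1
  pairCost-< x y lt with ∣ y ∣ <? ∣ x ∣
  ... | yes _ = refl
  ... | no nlt = ⊥-elim (nlt lt)

  pairCost-≮ : ∀ x y → ¬ (∣ y ∣ < ∣ x ∣) → pairCost x y ≡ isNeg y + isNeg y
  pairCost-≮ x y nlt with ∣ y ∣ <? ∣ x ∣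
  ... | yes lt = ⊥-elim (nlt lt)
  ... | no _ = refl

  pairCost-abs : ∀ x x′ e → ∣ x ∣ ≡ ∣ x′ ∣ → pairCost x e ≡ pairCost x′ e
  pairCost-abs x x′ e eq = cong (λ z → pairCostAbs z e) eq

  sumOver : List ℤ → (ℤ → ℕ) → ℕ
  sumOver [] f = 0
  sumOver (e ∷ l) f = f e + sumOver l f

  sumOver-++ : ∀ A B f → sumOver (A ++ B) f ≡ sumOver A f + sumOver B f
  sumOver-++ [] B f = refl
  sumOver-++ (a ∷ A) B f = trans (cong (λ z → f a + z) (sumOver-++ A B f)) (sym (NP.+-assoc (f a) _ _))

  sumOver-cong : ∀ l {f g} → All (λ e → f e ≡ g e) l → sumOver l f ≡ sumOver l g
  sumOver-cong [] [] = refl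
  sumOver-cong (e ∷ l) (h ∷ hs) = cong₂ _+_ h (sumOver-cong l hs)

  sumOver-+ : ∀ l f g → sumOver l f + sumOver l g ≡ sumOver l (λ e → f e + g e)
  sumOver-+ [] f g = refl
  sumOver-+ (e ∷ l) f g = trans (interchange (f e) (sumOver l f) (g e) (sumOver l g)) (cong (λ z → f e + g e + z) (sumOver-+ l f g))
    where
    interchange : ∀ a b c d → (a + b) + (c + d) ≡ (a + c) + (b + d)
    interchange = solve-∀

  sumOver₂-cong : ∀ l f g f′ g′ → All (λ e → f e + g e ≡ f′ e + g′ e) l →
    sumOver l f + sumOver l g ≡ sumOver l f′ + sumOver l g′
  sumOver₂-cong l f g f′ g′ h = trans (sumOver-+ l f g) (trans (sumOver-cong l h) (sym (sumOver-+ l f′ g′)))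

  invLength : List ℤ → ℕ
  invLength [] = 0
  invLength (x ∷ xs) = isNeg x + sumOver xs (pairCost x) + invLength xs

  ℓ : ∀ {n} → Vec ℤ n → ℕ
  ℓ w = invLength (toList w)

  yContribution : List ℤ → ℤ → List ℤ → ℕ
  yContribution B y D = sumOver B (λ a → pairCost a y) + isNeg y + sumOver D (pairCost y)

  invLength-remove : ∀ B y D → invLength (B ++ y ∷ D) ≡ invLength (B ++ D) + yContribution B y D
  invLength-remove [] y D = rearrange (isNeg y) (sumOver D (pairCost y)) (invLength D)
    where
    rearrange : ∀ a b c → a + b + c ≡ c + (0 + a + b)
    rearrange = solve-∀
  invLength-remove (b ∷ B) y D =
    trans (cong₂ (λ u v → isNeg b + u + v) (sumOver-++ B (y ∷ D) (pairCost b)) (invLength-remove B y D))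
    (trans (rearrange (isNeg b) (sumOver B (pairCost b)) (pairCost b y) (sumOver D (pairCost b)) (invLength (B ++ D))
                (sumOver B (λ a → pairCost a y)) (isNeg y) (sumOver D (pairCost y)))
    (cong (λ u → isNeg b + u + invLength (B ++ D) + yContribution (b ∷ B) y D) (sym (sumOver-++ B D (pairCost b)))))
    where
    rearrange : ∀ a s c t k e f g → a + (s + (c + t)) + (k + (e + f + g)) ≡ a + (s + t) + k + (c + e + f + g)
    rearrange = solve-∀

  localCost : ℤ → ℤ → ℕ
  localCost x y = isNeg x + isNeg y + pairCost x y

  invLength-two : ∀ A x B y D → invLength (A ++ x ∷ B ++ y ∷ D) ≡
    invLength (A ++ B ++ D)
    + (sumOver A (λ a → pairCost a x) + sumOver A (λ a → pairCost a y))
    + (sumOver B (pairCost x) + sumOver B (λ b → pairCost b y))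
    + (sumOver D (pairCost x) + sumOver D (pairCost y))
    + localCost x y
  invLength-two A x B y D =
    trans (invLength-remove A x (B ++ y ∷ D))
    (trans (cong₂ (λ u v → u + (sumOver A (λ a → pairCost a x) + isNeg x + v)) removeY xAfter)
    (rearrange (invLength (A ++ B ++ D)) (sumOver A (λ a → pairCost a x)) (sumOver A (λ a → pairCost a y))
         (sumOver B (pairCost x)) (sumOver B (λ b → pairCost b y)) (sumOver D (pairCost x)) (sumOver D (pairCost y))
         (isNeg x) (isNeg y) (pairCost x y)))
    where
    removeY : invLength (A ++ B ++ y ∷ D) ≡
      invLength (A ++ B ++ D) + (sumOver A (λ a → pairCost a y) + sumOver B (λ b → pairCost b y) + isNeg y + sumOver D (pairCost y))
    removeY =
      trans (cong invLength (sym (LP.++-assoc A B (y ∷ D))))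
      (trans (invLength-remove (A ++ B) y D)
      (cong₂ (λ u v → u + (v + isNeg y + sumOver D (pairCost y)))
             (cong invLength (LP.++-assoc A B D)) (sumOver-++ A B (λ a → pairCost a y))))
    xAfter : sumOver (B ++ y ∷ D) (pairCost x) ≡ sumOver B (pairCost x) + sumOver D (pairCost x) + pairCost x y
    xAfter =
      trans (sumOver-++ B (y ∷ D) (pairCost x))
      (regroup (sumOver B (pairCost x)) (pairCost x y) (sumOver D (pairCost x)))
      where
      regroup : ∀ a b c → a + (b + c) ≡ a + c + b
      regroup = solve-∀
    rearrange : ∀ K ax ay xb by xd yd nx ny cxy →
      K + (ay + by + ny + yd) + (ax + nx + (xb + xd + cxy)) ≡ K + (ax + ay) + (xb + by) + (xd + yd) + (nx + ny + cxy)
    rearrange = solve-∀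

  SameCostLeft : ℤ → ℤ → ℤ → ℤ → ℤ → Set
  SameCostLeft x y x′ y′ e = pairCost e x + pairCost e y ≡ pairCost e x′ + pairCost e y′

  SameCostBetween : ℤ → ℤ → ℤ → ℤ → ℤ → Set
  SameCostBetween x y x′ y′ e = pairCost x e + pairCost e y ≡ pairCost x′ e + pairCost e y′

  SameCostRight : ℤ → ℤ → ℤ → ℤ → ℤ → Set
  SameCostRight x y x′ y′ e = pairCost x e + pairCost y e ≡ pairCost x′ e + pairCost y′ e

  twoPositions : ∀ A B D x y x′ y′ →
    All (SameCostLeft x y x′ y′) A →
    All (SameCostBetween x y x′ y′) B →
    All (SameCostRight x y x′ y′) D →
    invLength (A ++ x′ ∷ B ++ y′ ∷ D) + localCost x y ≡ invLength (A ++ x ∷ B ++ y ∷ D) + localCost x′ y′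
  twoPositions A B D x y x′ y′ hA hB hD = begin
    invLength (A ++ x′ ∷ B ++ y′ ∷ D) + localCost x y
      ≡⟨ cong (_+ localCost x y) (invLength-two A x′ B y′ D) ⟩
    rest x′ y′ + localCost x′ y′ + localCost x y
      ≡⟨ cong (λ z → z + localCost x′ y′ + localCost x y) (sym restEq) ⟩
    rest x y + localCost x′ y′ + localCost x y
      ≡⟨ swap₃ (rest x y) (localCost x′ y′) (localCost x y) ⟩
    rest x y + localCost x y + localCost x′ y′
      ≡⟨ cong (_+ localCost x′ y′) (sym (invLength-two A x B y D)) ⟩
    invLength (A ++ x ∷ B ++ y ∷ D) + localCost x′ y′ ∎
    where
    open ≡-Reasoning
    rest : ℤ → ℤ → ℕ
    rest u v = invLength (A ++ B ++ D)
      + (sumOver A (λ a → pairCost a u) + sumOver A (λ a → pairCost a v))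
      + (sumOver B (pairCost u) + sumOver B (λ b → pairCost b v))
      + (sumOver D (pairCost u) + sumOver D (pairCost v))
    restEq : rest x y ≡ rest x′ y′
    restEq = cong₂ _+_ (cong₂ _+_ (cong (λ z → invLength (A ++ B ++ D) + z)
        (sumOver₂-cong A _ _ _ _ hA)) (sumOver₂-cong B _ _ _ _ hB)) (sumOver₂-cong D _ _ _ _ hD)
    swap₃ : ∀ a b c → a + b + c ≡ a + c + b
    swap₃ = solve-∀

  onePosition : ∀ B D y y′ → All (λ a → pairCost a y ≡ pairCost a y′) B → All (λ e → pairCost y e ≡ pairCost y′ e) D →
    invLength (B ++ y′ ∷ D) + isNeg y ≡ invLength (B ++ y ∷ D) + isNeg y′
  onePosition B D y y′ hB hD =
    trans (cong (_+ isNeg y) (invLength-remove B y′ D))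
    (trans (cong₂ (λ u v → invLength (B ++ D) + (u + isNeg y′ + v) + isNeg y) (sym (sumOver-cong B hB)) (sym (sumOver-cong D hD)))
    (trans (rearrange (invLength (B ++ D)) (sumOver B (λ a → pairCost a y)) (isNeg y′) (sumOver D (pairCost y)) (isNeg y))
    (cong (_+ isNeg y′) (sym (invLength-remove B y D)))))
    where
    rearrange : ∀ k a b c d → k + (a + b + c) + d ≡ k + (a + d + c) + b
    rearrange = solve-∀

  -- The absolute values of the entries of w are 1..n, each once.  This is
  -- what the length computation uses of IsSignedPerm.
  record WellFormed {n} (w : Vec ℤ n) : Set where
    field
      inRange : ∀ m → m < n → 1 ≤ ∣ at w m ∣ × ∣ at w m ∣ ≤ n
      absInjective : ∀ m m′ → m < n → m′ < n → ∣ at w m ∣ ≡ ∣ at w m′ ∣ → m ≡ m′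
  open WellFormed

  absDistinct : ∀ {n} {w : Vec ℤ n} → WellFormed w → ∀ m → m < n → (P : Fin n) → m ≢ toℕ P → ∣ at w m ∣ ≢ ∣ lookup w P ∣
  absDistinct {w = w} wf m lt P ne e = ne (absInjective wf m (toℕ P) lt (toℕ<n P) (trans e (cong ∣_∣ (sym (at-lookup w P)))))

  wellFormed-actGen : ∀ {n} (w : Vec ℤ n) g → WellFormed w → WellFormed (actGen w g)
  wellFormed-actGen {suc n} w s₀ wf = record
    { inRange = λ m lt → subst (λ z → 1 ≤ z × z ≤ suc n) (sym (sameAbs m)) (inRange wf m lt)
    ; absInjective = λ m m′ lt lt′ e → absInjective wf m m′ lt lt′ (trans (sym (sameAbs m)) (trans e (sameAbs m′)))
    }
    where
    sameAbs : ∀ m → ∣ at (actGen w s₀) m ∣ ≡ ∣ at w m ∣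
    sameAbs m = trans (cong ∣_∣ (at-s₀ w m)) (∣negateAt∣ 0 (at w) m)
  wellFormed-actGen {n} w (s i pf) wf = record
    { inRange = λ m lt → subst (λ z → 1 ≤ ∣ z ∣ × ∣ z ∣ ≤ n) (sym (at-s w i pf m)) (inRange wf _ (moved m lt))
    ; absInjective = λ m m′ lt lt′ e →
        trans (sym (transp-involutive i (suc i) m)) (trans (cong (transp i (suc i))
          (absInjective wf _ _ (moved m lt) (moved m′ lt′)
            (trans (cong ∣_∣ (sym (at-s w i pf m))) (trans e (cong ∣_∣ (at-s w i pf m′))))))
          (transp-involutive i (suc i) m′))
    }
    where
    moved : ∀ m → m < n → transp i (suc i) m < n
    moved m lt = transp-< i (suc i) m (NP.<-trans (NP.n<1+n i) pf) pf lt

  wellFormed-act : ∀ {n} (w : Vec ℤ n) ws → WellFormed w → WellFormed (act w ws)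
  wellFormed-act w [] wf = wf
  wellFormed-act w (g ∷ ws) wf = wellFormed-act (actGen w g) ws (wellFormed-actGen w g wf)

  at-tabulate : ∀ {n} (f : Fin n → ℤ) m (lt : m < n) → at (tabulate f) m ≡ f (fromℕ< lt)
  at-tabulate {suc n} f zero lt = refl
  at-tabulate {suc n} f (suc m) (s≤s lt) = at-tabulate (λ j → f (Fin.suc j)) m lt

  at-idW : ∀ n m → m < n → at (idW n) m ≡ + suc m
  at-idW n m lt = trans (at-tabulate _ m lt) (cong (λ z → + suc z) (toℕ-fromℕ< lt))

  wellFormed-idW : ∀ n → WellFormed (idW n)
  wellFormed-idW n = record
    { inRange = λ m lt → subst (λ z → 1 ≤ ∣ z ∣ × ∣ z ∣ ≤ n) (sym (at-idW n m lt)) (s≤s z≤n , lt)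
    ; absInjective = λ m m′ lt lt′ e →
        NP.suc-injective (trans (cong ∣_∣ (sym (at-idW n m lt))) (trans e (cong ∣_∣ (at-idW n m′ lt′))))
    }

  allPositions : ∀ {n} (xs : Vec ℤ n) → All (λ e → Σ[ m ∈ ℕ ] (m < n × at xs m ≡ e)) (toList xs)
  allPositions [] = []
  allPositions (x ∷ xs) = (0 , s≤s z≤n , refl) ∷ All.map (λ { (m , lt , eq) → suc m , s≤s lt , eq }) (allPositions xs)

  invLength-increasing : ∀ n k → invLength (toList (tabulate {n = n} (λ j → + suc (k + toℕ j)))) ≡ 0
  invLength-increasing zero k = refl
  invLength-increasing (suc n) k =
    trans (cong (λ (t : Vec ℤ n) → isNeg x₀ + sumOver (toList t) (pairCost x₀) + invLength (toList t)) shift)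
    (cong₂ _+_ (sumOver-zero (toList rest) (All.map noCost (allPositions rest))) (invLength-increasing n (suc k)))
    where
    x₀ : ℤ
    x₀ = + suc (k + 0)
    rest : Vec ℤ n
    rest = tabulate (λ j → + suc (suc k + toℕ j))
    shift : tabulate (λ j → + suc (k + suc (toℕ j))) ≡ rest
    shift = VP.tabulate-cong (λ j → cong (λ z → + suc z) (NP.+-suc k (toℕ j)))
    sumOver-zero : ∀ l → All (λ e → pairCost x₀ e ≡ 0) l → sumOver l (pairCost x₀) ≡ 0
    sumOver-zero [] [] = refl
    sumOver-zero (e ∷ l) (h ∷ hs) = cong₂ _+_ h (sumOver-zero l hs)
    noCost : ∀ {e} → Σ[ m ∈ ℕ ] (m < n × at rest m ≡ e) → pairCost x₀ e ≡ 0
    noCost (m , lt , refl) rewrite at-tabulate (λ j → + suc (suc k + toℕ j)) m lt =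
      pairCost-≮ x₀ (+ suc (suc k + t)) (NP.≤⇒≯ (s≤s (NP.≤-trans (NP.≤-reflexive (NP.+-identityʳ k))
        (NP.≤-trans (NP.m≤m+n k t) (NP.n≤1+n _)))))
      where
      t : ℕ
      t = toℕ (fromℕ< lt)

  ℓ-idW : ∀ n → ℓ (idW n) ≡ 0
  ℓ-idW n = invLength-increasing n 0

  EntryBefore : ∀ {n} → Vec ℤ n → ℕ → ℤ → Set
  EntryBefore w p e = Σ[ m ∈ ℕ ] (m < p × at w m ≡ e)

  EntryBetween : ∀ {n} → Vec ℤ n → ℕ → ℕ → ℤ → Set
  EntryBetween w p q e = Σ[ m ∈ ℕ ] (p < m × m < q × at w m ≡ e)

  EntryAfter : ∀ {n} → Vec ℤ n → ℕ → ℤ → Set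
  EntryAfter {n} w q e = Σ[ m ∈ ℕ ] (q < m × m < n × at w m ≡ e)

  splitAt₁ : ∀ {n} (w : Vec ℤ n) (p : Fin n) → Σ[ A ∈ List ℤ ] Σ[ D ∈ List ℤ ]
    ((∀ v → toList (w [ p ]≔ v) ≡ A ++ v ∷ D) × All (EntryBefore w (toℕ p)) A × All (EntryAfter w (toℕ p)) D)
  splitAt₁ (x ∷ xs) Fin.zero = [] , toList xs , (λ v → refl) , [] ,
    All.map (λ { (m , lt , eq) → suc m , s≤s z≤n , s≤s lt , eq }) (allPositions xs)
  splitAt₁ (x ∷ xs) (Fin.suc p) with splitAt₁ xs p
  ... | A , D , eq , hA , hD = x ∷ A , D , (λ v → cong (x ∷_) (eq v)) ,
    (0 , s≤s z≤n , refl) ∷ All.map (λ { (m , lt , e) → suc m , s≤s lt , e }) hA ,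
    All.map (λ { (m , lt , lt′ , e) → suc m , s≤s lt , s≤s lt′ , e }) hD

  splitAt₂ : ∀ {n} (w : Vec ℤ n) (p q : Fin n) → toℕ p < toℕ q → Σ[ A ∈ List ℤ ] Σ[ B ∈ List ℤ ] Σ[ D ∈ List ℤ ]
    ((∀ v v′ → toList ((w [ p ]≔ v) [ q ]≔ v′) ≡ A ++ v ∷ B ++ v′ ∷ D) ×
     All (EntryBefore w (toℕ p)) A × All (EntryBetween w (toℕ p) (toℕ q)) B × All (EntryAfter w (toℕ q)) D)
  splitAt₂ (x ∷ xs) Fin.zero (Fin.suc q) lt with splitAt₁ xs q
  ... | B , D , eq , hB , hD = [] , B , D , (λ v v′ → cong (v ∷_) (eq v′)) , [] ,
    All.map (λ { (m , lt , e) → suc m , s≤s z≤n , s≤s lt , e }) hB ,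
    All.map (λ { (m , lt , lt′ , e) → suc m , s≤s lt , s≤s lt′ , e }) hD
  splitAt₂ (x ∷ xs) (Fin.suc p) (Fin.suc q) (s≤s lt) with splitAt₂ xs p q lt
  ... | A , B , D , eq , hA , hB , hD = x ∷ A , B , D , (λ v v′ → cong (x ∷_) (eq v v′)) ,
    (0 , s≤s z≤n , refl) ∷ All.map (λ { (m , lt , e) → suc m , s≤s lt , e }) hA ,
    All.map (λ { (m , lt , lt′ , e) → suc m , s≤s lt , s≤s lt′ , e }) hB ,
    All.map (λ { (m , lt , lt′ , e) → suc m , s≤s lt , s≤s lt′ , e }) hD

  ℓ-replace₂ : ∀ {n} (w : Vec ℤ n) (p q : Fin n) → toℕ p < toℕ q → ∀ x′ y′ →
    (∀ e → EntryBefore w (toℕ p) e → SameCostLeft (lookup w p) (lookup w q) x′ y′ e) →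
    (∀ e → EntryBetween w (toℕ p) (toℕ q) e → SameCostBetween (lookup w p) (lookup w q) x′ y′ e) →
    (∀ e → EntryAfter w (toℕ q) e → SameCostRight (lookup w p) (lookup w q) x′ y′ e) →
    ℓ ((w [ p ]≔ x′) [ q ]≔ y′) + localCost (lookup w p) (lookup w q) ≡ ℓ w + localCost x′ y′
  ℓ-replace₂ w p q lt x′ y′ cA cB cD with splitAt₂ w p q lt
  ... | A , B , D , eq , hA , hB , hD =
    trans (cong (λ z → invLength z + localCost wp wq) (eq x′ y′))
    (trans (twoPositions A B D wp wq x′ y′ (All.map (cA _) hA) (All.map (cB _) hB) (All.map (cD _) hD))
    (cong (λ z → invLength z + localCost x′ y′) (trans (sym (eq wp wq)) (cong toList (update₂-self w p q)))))
    where
    wp wq : ℤ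
    wp = lookup w p
    wq = lookup w q

  ℓ-replace₁ : ∀ {n} (w : Vec ℤ n) (p : Fin n) x′ →
    (∀ e → EntryBefore w (toℕ p) e → pairCost e (lookup w p) ≡ pairCost e x′) →
    (∀ e → EntryAfter w (toℕ p) e → pairCost (lookup w p) e ≡ pairCost x′ e) →
    ℓ (w [ p ]≔ x′) + isNeg (lookup w p) ≡ ℓ w + isNeg x′
  ℓ-replace₁ w p x′ cA cD with splitAt₁ w p
  ... | A , D , eq , hA , hD =
    trans (cong (λ z → invLength z + isNeg wp) (eq x′))
    (trans (onePosition A D wp x′ (All.map (cA _) hA) (All.map (cD _) hD))
    (cong (λ z → invLength z + isNeg x′) (trans (sym (eq wp)) (cong toList (VP.[]≔-lookup w p)))))
    where
    wp : ℤ
    wp = lookup w p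

  ℓ-negateFirst : ∀ {n} x (xs : Vec ℤ n) → ℓ (actGen (x ∷ xs) s₀) + isNeg x ≡ ℓ (x ∷ xs) + isNeg (- x)
  ℓ-negateFirst x xs = trans (cong (λ z → isNeg (- x) + z + ℓ xs + isNeg x) sameCosts) (rearrange (isNeg (- x)) _ (ℓ xs) (isNeg x))
    where
    sameCosts : sumOver (toList xs) (pairCost (- x)) ≡ sumOver (toList xs) (pairCost x)
    sameCosts = sumOver-cong (toList xs) (All.tabulate (λ {e} _ → pairCost-abs (- x) x e (ZP.∣-i∣≡∣i∣ x)))
    rearrange : ∀ a b c d → a + b + c + d ≡ d + b + c + a
    rearrange = solve-∀

  ℓ-adjacentSwap : ∀ {n} (w : Vec ℤ n) i (pf : suc i < n) →
    ℓ (actGen w (s i pf)) + localCost (at w i) (at w (suc i)) ≡ ℓ w + localCost (at w (suc i)) (at w i)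
  ℓ-adjacentSwap {n} w i pf =
    subst₂ (λ u v → ℓ (actGen w (s i pf)) + localCost u v ≡ ℓ w + localCost v u)
      (at-fromℕ< w i i<n) (at-fromℕ< w (suc i) pf)
      (ℓ-replace₂ w P Q P<Q (lookup w Q) (lookup w P)
        (λ e _ → NP.+-comm (pairCost e (lookup w P)) (pairCost e (lookup w Q)))
        (λ e (m , l₁ , l₂ , _) → ⊥-elim (NP.<⇒≱ (subst (_< m) (toℕ-fromℕ< i<n) l₁) (NP.≤-pred (subst (m <_) (toℕ-fromℕ< pf) l₂))))
        (λ e _ → NP.+-comm (pairCost (lookup w P) e) (pairCost (lookup w Q) e)))
    where
    i<n : i < n
    i<n = NP.<-trans (NP.n<1+n i) pf
    P Q : Fin n
    P = fromℕ< i<n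
    Q = fromℕ< pf
    P<Q : toℕ P < toℕ Q
    P<Q = subst₂ _<_ (sym (toℕ-fromℕ< i<n)) (sym (toℕ-fromℕ< pf)) (NP.n<1+n i)

  isNeg≤1 : ∀ x → isNeg x ≤ 1
  isNeg≤1 (+ _) = z≤n
  isNeg≤1 -[1+ _ ] = s≤s z≤n

  pairCost≤2 : ∀ x y → pairCost x y ≤ 2
  pairCost≤2 x y with ∣ y ∣ <? ∣ x ∣
  ... | yes _ = s≤s z≤n
  ... | no _ = NP.+-mono-≤ (isNeg≤1 y) (isNeg≤1 y)

  pairCost-reverse-≤ : ∀ x y → ∣ x ∣ ≢ ∣ y ∣ → pairCost y x ≤ suc (pairCost x y)
  pairCost-reverse-≤ x y ne with NP.<-cmp ∣ x ∣ ∣ y ∣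
  ... | tri< l _ _ = subst (_≤ suc (pairCost x y)) (sym (pairCost-< y x l)) (s≤s z≤n)
  ... | tri≈ _ e _ = ⊥-elim (ne e)
  ... | tri> _ _ g = subst (λ z → pairCost y x ≤ suc z) (sym (pairCost-< x y g)) (pairCost≤2 y x)

  pairCost-reverse-< : ∀ x y → ∣ x ∣ ≢ ∣ y ∣ → pairCost y x < pairCost x y → pairCost x y ≡ suc (pairCost y x)
  pairCost-reverse-< x y ne d with NP.<-cmp ∣ x ∣ ∣ y ∣
  ... | tri< l _ _ = sym (trans (cong suc (pairCost-< y x l))
                      (NP.≤-antisym (subst (λ z → suc z ≤ pairCost x y) (pairCost-< y x l) d) (pairCost≤2 x y)))
  ... | tri≈ _ e _ = ⊥-elim (ne e)
  ... | tri> _ _ g = sym (trans (NP.≤-antisym (subst (λ z → suc (pairCost y x) ≤ z) (pairCost-< x y g) d) (s≤s z≤n))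
                      (sym (pairCost-< x y g)))

  pairCost-ascent : ∀ x y → isNeg x ≡ 0 → ∣ x ∣ ≢ ∣ y ∣ → ¬ (pairCost y x < pairCost x y) → isNeg y ≡ 0 × ∣ x ∣ < ∣ y ∣
  pairCost-ascent x y nx ne nd with NP.<-cmp ∣ x ∣ ∣ y ∣
  ... | tri≈ _ e _ = ⊥-elim (ne e)
  ... | tri> _ _ g = ⊥-elim (nd (subst₂ _<_ (sym (trans (pairCost-≮ y x (NP.<-asym g)) (cong₂ _+_ nx nx)))
                                           (sym (pairCost-< x y g)) (s≤s z≤n)))
  ... | tri< l _ _ = nonNeg y (pairCost-< y x l) (pairCost-≮ x y (NP.<-asym l)) nd , l
    where
    nonNeg : ∀ z → pairCost z x ≡ 1 → pairCost x z ≡ isNeg z + isNeg z → ¬ (pairCost z x < pairCost x z) → isNeg z ≡ 0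
    nonNeg (+ _) _ _ _ = refl
    nonNeg -[1+ k ] e₁ e₂ nd′ = ⊥-elim (nd′ (subst₂ _<_ (sym e₁) (sym e₂) (s≤s (s≤s z≤n))))

  adjacentDistinct : ∀ {n} {w : Vec ℤ n} → WellFormed w → ∀ i → suc i < n → ∣ at w i ∣ ≢ ∣ at w (suc i) ∣
  adjacentDistinct wf i pf e = suc≢ i (sym (absInjective wf i (suc i) (NP.<-trans (NP.n<1+n i) pf) pf e))

  differByAtMostOne : ∀ a b c d → a + c ≡ b + d → d ≤ suc c → a ≤ suc b
  differByAtMostOne a b c d e d≤ = NP.+-cancelʳ-≤ c a (suc b)
    (NP.≤-trans (NP.≤-reflexive e) (NP.≤-trans (NP.+-monoʳ-≤ b d≤) (NP.≤-reflexive (NP.+-suc b c))))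

  differByOne : ∀ a b c d → a + c ≡ b + d → c ≡ suc d → suc a ≡ b
  differByOne a b c d e refl = NP.+-cancelʳ-≡ d (suc a) b (trans (sym (NP.+-suc a d)) e)

  ℓ-actGen-≤ : ∀ {n} (w : Vec ℤ n) g → WellFormed w → ℓ (actGen w g) ≤ suc (ℓ w)
  ℓ-actGen-≤ (x ∷ xs) s₀ wf =
    differByAtMostOne _ _ (isNeg x) (isNeg (- x)) (ℓ-negateFirst x xs) (NP.≤-trans (isNeg≤1 (- x)) (s≤s z≤n))
  ℓ-actGen-≤ w (s i pf) wf =
    differByAtMostOne _ _ (localCost x y) (localCost y x) (ℓ-adjacentSwap w i pf)
      (subst (localCost y x ≤_) (rearrange (isNeg x) (isNeg y) (pairCost x y))
        (NP.+-monoʳ-≤ (isNeg y + isNeg x) (pairCost-reverse-≤ x y (adjacentDistinct wf i pf))))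
    where
    x y : ℤ
    x = at w i
    y = at w (suc i)
    rearrange : ∀ a b c → b + a + suc c ≡ suc (a + b + c)
    rearrange = solve-∀

  ℓ-act-≤ : ∀ {n} ws (w : Vec ℤ n) → WellFormed w → ℓ (act w ws) ≤ ℓ w + length ws
  ℓ-act-≤ [] w wf = NP.m≤m+n (ℓ w) 0
  ℓ-act-≤ (g ∷ ws) w wf = NP.≤-trans (ℓ-act-≤ ws (actGen w g) (wellFormed-actGen w g wf))
    (NP.≤-trans (NP.+-monoˡ-≤ (length ws) (ℓ-actGen-≤ w g wf)) (NP.≤-reflexive (sym (NP.+-suc (ℓ w) (length ws)))))

  Descent : ∀ {n} → Vec ℤ n → Set
  Descent {n} w = Σ[ g ∈ Gen n ] suc (ℓ (actGen w g)) ≡ ℓ w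

  descent-s₀ : ∀ {n} k (xs : Vec ℤ n) → Descent (-[1+ k ] ∷ xs)
  descent-s₀ k xs = s₀ , differByOne _ _ 1 0 (ℓ-negateFirst -[1+ k ] xs) refl

  descent-s : ∀ {n} (w : Vec ℤ n) i (pf : suc i < n) → WellFormed w →
    pairCost (at w (suc i)) (at w i) < pairCost (at w i) (at w (suc i)) → Descent w
  descent-s w i pf wf d = s i pf ,
    differByOne _ _ (localCost x y) (localCost y x) (ℓ-adjacentSwap w i pf)
      (trans (cong (λ z → isNeg x + isNeg y + z) (pairCost-reverse-< x y (adjacentDistinct wf i pf) d))
             (rearrange (isNeg x) (isNeg y) (pairCost y x)))
    where
    x y : ℤ
    x = at w i
    y = at w (suc i)
    rearrange : ∀ a b c → a + b + suc c ≡ suc (b + a + c)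
    rearrange = solve-∀

  -- A well-formed w whose entries are non-negative with strictly increasing
  -- absolute values is the identity: ∣w(j)∣ is squeezed between j+1 (from
  -- below, by induction) and j+1 (from above, counting up to ∣w(n′)∣ ≤ n′+1).
  increasing⇒idW : ∀ {n′} (w : Vec ℤ (suc n′)) → WellFormed w →
    (∀ j → j ≤ n′ → isNeg (at w j) ≡ 0) → (∀ j → j < n′ → ∣ at w j ∣ < ∣ at w (suc j) ∣) → w ≡ idW (suc n′)
  increasing⇒idW {n′} w wf nonNeg incr = at-ext _ _ λ m lt →
    trans (nonNeg⇒abs (at w m) (nonNeg m (NP.≤-pred lt)))
    (trans (cong +_ (NP.≤-antisym (upper m (NP.≤-pred lt)) (lower m (NP.≤-pred lt)))) (sym (at-idW (suc n′) m lt)))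
    where
    f : ℕ → ℕ
    f j = ∣ at w j ∣
    nonNeg⇒abs : ∀ z → isNeg z ≡ 0 → z ≡ + ∣ z ∣
    nonNeg⇒abs (+ _) _ = refl
    lower : ∀ j → j ≤ n′ → suc j ≤ f j
    lower zero _ = proj₁ (inRange wf 0 (s≤s z≤n))
    lower (suc j) h = NP.≤-trans (s≤s (lower j (NP.<⇒≤ h))) (incr j h)
    climb : ∀ k j → j + k ≤ n′ → f j + k ≤ f (j + k)
    climb zero j h = NP.≤-reflexive (trans (NP.+-identityʳ (f j)) (cong f (sym (NP.+-identityʳ j))))
    climb (suc k) j h =
      NP.≤-trans (NP.≤-reflexive (NP.+-suc (f j) k))
      (NP.≤-trans (s≤s (climb k j (NP.≤-trans (NP.+-monoʳ-≤ j (NP.n≤1+n k)) h)))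
      (NP.≤-trans (incr (j + k) (subst (_≤ n′) (NP.+-suc j k) h)) (NP.≤-reflexive (cong f (sym (NP.+-suc j k))))))
    upper : ∀ j → j ≤ n′ → f j ≤ suc j
    upper j h = NP.+-cancelʳ-≤ (n′ ∸ j) (f j) (suc j)
      (NP.≤-trans (climb (n′ ∸ j) j (NP.≤-reflexive e))
      (NP.≤-trans (NP.≤-reflexive (cong f e))
      (NP.≤-trans (proj₂ (inRange wf n′ (NP.n<1+n n′))) (NP.≤-reflexive (cong suc (sym e))))))
      where
      e : j + (n′ ∸ j) ≡ n′
      e = NP.m+[n∸m]≡n h

  -- Every well-formed element other than the identity has a descent.  Scan
  -- left to right; while no descent is found, the scanned prefix is
  -- non-negative and increasing in absolute value.
  descentOrIdentity : ∀ {n} (w : Vec ℤ n) → WellFormed w → Descent w ⊎ w ≡ idW n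
  descentOrIdentity [] _ = inj₂ refl
  descentOrIdentity (-[1+ k ] ∷ xs) _ = inj₁ (descent-s₀ k xs)
  descentOrIdentity {suc n′} (+ a ∷ xs) wf = scan n′ 0 refl (λ { zero _ → refl }) (λ j ())
    where
    w : Vec ℤ (suc n′)
    w = + a ∷ xs
    scan : ∀ k i → i + k ≡ n′ → (∀ j → j ≤ i → isNeg (at w j) ≡ 0) →
           (∀ j → j < i → ∣ at w j ∣ < ∣ at w (suc j) ∣) → Descent w ⊎ w ≡ idW (suc n′)
    scan zero i e nonNeg incr = inj₂ (increasing⇒idW w wf (λ j h → nonNeg j (subst (j ≤_) (sym i≡n′) h))
                                                         (λ j h → incr j (subst (j <_) (sym i≡n′) h)))
      where
      i≡n′ : i ≡ n′
      i≡n′ = trans (sym (NP.+-identityʳ i)) e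
    scan (suc k) i e nonNeg incr = atPosition (s≤s (subst (suc i ≤_) e (NP.m<m+n i (s≤s z≤n))))
      where
      atPosition : suc i < suc n′ → Descent w ⊎ w ≡ idW (suc n′)
      atPosition pf with pairCost (at w (suc i)) (at w i) <? pairCost (at w i) (at w (suc i))
      ... | yes d = inj₁ (descent-s w i pf wf d)
      ... | no nd = scan k (suc i) (trans (sym (NP.+-suc i k)) e) nonNeg′ incr′
        where
        ascent : isNeg (at w (suc i)) ≡ 0 × ∣ at w i ∣ < ∣ at w (suc i) ∣
        ascent = pairCost-ascent (at w i) (at w (suc i)) (nonNeg i NP.≤-refl) (adjacentDistinct wf i pf) nd
        nonNeg′ : ∀ j → j ≤ suc i → isNeg (at w j) ≡ 0
        nonNeg′ j h with NP.m≤n⇒m<n∨m≡n h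
        ... | inj₁ l = nonNeg j (NP.≤-pred l)
        ... | inj₂ refl = proj₁ ascent
        incr′ : ∀ j → j < suc i → ∣ at w j ∣ < ∣ at w (suc j) ∣
        incr′ j h with NP.m≤n⇒m<n∨m≡n (NP.≤-pred h)
        ... | inj₁ l = incr j l
        ... | inj₂ refl = proj₂ ascent

  wordOfLength : ∀ N {n} (w : Vec ℤ n) → WellFormed w → ℓ w ≡ N → Σ[ ws ∈ List (Gen n) ] (length ws ≡ N × prod ws ≡ w)
  wordOfLength N {n} w wf eN with descentOrIdentity w wf
  ... | inj₂ e = [] , trans (sym (ℓ-idW n)) (trans (cong ℓ (sym e)) eN) , sym e
  wordOfLength zero w wf eN | inj₁ (g , d) = ⊥-elim (NP.1+n≢0 (trans d eN))
  wordOfLength (suc N) {n} w wf eN | inj₁ (g , d) with wordOfLength N (actGen w g) (wellFormed-actGen w g wf) (NP.suc-injective (trans d eN))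
  ... | ws , len , eq = ws ++ [ g ] ,
     trans (LP.length-++ ws) (trans (cong (_+ 1) len) (NP.+-comm N 1)) ,
     trans (act-++ (idW n) ws [ g ]) (trans (cong (λ z → actGen z g) eq) (actGen-involutive w g))

  -- invLength is the Coxeter length: it is attained by a word, and no word
  -- is shorter since each generator raises invLength by at most one.
  coxeterLength : ∀ {n} (w : Vec ℤ n) → WellFormed w → Length w (ℓ w)
  coxeterLength {n} w wf = wordOfLength (ℓ w) w wf refl ,
    λ ws eq → subst (λ z → ℓ z ≤ length ws) eq
       (NP.≤-trans (ℓ-act-≤ ws (idW n) (wellFormed-idW n)) (NP.≤-reflexive (cong (_+ length ws) (ℓ-idW n))))

  absolutes : ∀ {n} → Vec ℤ n → List ℕ
  absolutes w = map ∣_∣ (toList w)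

  at∈absolutes : ∀ {n} (w : Vec ℤ n) m → m < n → ∣ at w m ∣ ∈ absolutes w
  at∈absolutes (x ∷ w) zero lt = here refl
  at∈absolutes (x ∷ w) (suc m) (s≤s lt) = there (at∈absolutes w m lt)

  all-at : ∀ {n} {P : ℕ → Set} (w : Vec ℤ n) → All P (absolutes w) → ∀ m → m < n → P ∣ at w m ∣
  all-at (x ∷ w) (h ∷ hs) zero lt = h
  all-at (x ∷ w) (h ∷ hs) (suc m) (s≤s lt) = all-at w hs m lt

  unique-at : ∀ {n} (w : Vec ℤ n) → Unique (absolutes w) → ∀ m m′ → m < m′ → m′ < n → ∣ at w m ∣ ≢ ∣ at w m′ ∣
  unique-at (x ∷ w) (h ∷ hs) zero (suc m′) lt (s≤s lt′) = all-at {P = λ z → ∣ x ∣ ≢ z} w h m′ lt′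
  unique-at (x ∷ w) (h ∷ hs) (suc m) (suc m′) (s≤s lt) (s≤s lt′) = unique-at w hs m m′ lt lt′

  -- A signed permutation is well formed: its absolute values are a
  -- permutation of the duplicate-free list 1..n.
  signedPerm⇒wellFormed : ∀ {n} (w : Vec ℤ n) → IsSignedPerm w → WellFormed w
  signedPerm⇒wellFormed {n} w perm = record { inRange = range ; absInjective = injective }
    where
    range : ∀ m → m < n → 1 ≤ ∣ at w m ∣ × ∣ at w m ∣ ≤ n
    range m lt with ∈-map⁻ suc (∈-resp-↭ perm (at∈absolutes w m lt))
    ... | y , y∈ , e = subst (λ z → 1 ≤ z × z ≤ n) (sym e) (s≤s z≤n , ∈-upTo⁻ y∈)
    unique : Unique (absolutes w)
    unique = PermSetoid.Unique-resp-↭ (setoid ℕ) (↭⇒↭ₛ (↭-sym perm)) (UniqueP.map⁺ NP.suc-injective (UniqueP.upTo⁺ n))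
    injective : ∀ m m′ → m < n → m′ < n → ∣ at w m ∣ ≡ ∣ at w m′ ∣ → m ≡ m′
    injective m m′ lt lt′ e with NP.<-cmp m m′
    ... | tri< l _ _ = ⊥-elim (unique-at w unique m m′ l lt′ e)
    ... | tri≈ _ q _ = q
    ... | tri> _ _ g = ⊥-elim (unique-at w unique m′ m g lt (sym e))

  coverByReflection : ∀ {n} (w′ w : Vec ℤ n) (u : List (Gen n)) g → w ≡ act w′ (reflWord u g) → WellFormed w′ →
    ℓ w ≡ suc (ℓ w′) → Covers w w′
  coverByReflection w′ w u g e wf eℓ =
    (((u , g , e) , ℓ w′ , suc (ℓ w′) , lenW′ , lenW , NP.n<1+n _) ◅ ε) , ℓ w′ , lenW′ , lenW
    where
    lenW′ : Length w′ (ℓ w′)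
    lenW′ = coxeterLength w′ wf
    lenW : Length w (suc (ℓ w′))
    lenW = subst (Length w) eℓ (coxeterLength w (subst WellFormed (sym e) (wellFormed-act w′ (reflWord u g) wf)))

  coverByNegation : ∀ {n} (w : Vec ℤ (suc n)) (p : Fin (suc n)) x → WellFormed w → lookup w p ≡ x →
    (∀ m → m < toℕ p → ∣ at w m ∣ ≢ ∣ x ∣ → pairCost (at w m) x ≡ pairCost (at w m) (- x)) →
    isNeg (- x) ≡ suc (isNeg x) →
    Covers (w [ p ]≔ - x) w
  coverByNegation w p _ wf refl before becomesNeg =
    coverByReflection w _ (negateWordAt p) s₀ (sym (act-negateWordAt w p)) wf
      (sym (differByOne (ℓ w) _ _ _ (sym (ℓ-replace₁ w p (- wp) cA cD)) becomesNeg))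
    where
    wp : ℤ
    wp = lookup w p
    cA : ∀ e → EntryBefore w (toℕ p) e → pairCost e wp ≡ pairCost e (- wp)
    cA e (m , lt , refl) = before m lt (absDistinct wf m (NP.<-trans lt (toℕ<n p)) p (NP.<⇒≢ lt))
    cD : ∀ e → EntryAfter w (toℕ p) e → pairCost wp e ≡ pairCost (- wp) e
    cD e _ = pairCost-abs wp (- wp) e (sym (ZP.∣-i∣≡∣i∣ wp))

  -- Cover criterion for exchanging the entries x, y in positions p < q:
  -- entries between p and q must cost the same before and after (entries
  -- outside always do), and the local cost must rise by one.
  coverBySwap : ∀ {n} (w : Vec ℤ (suc n)) (p q : Fin (suc n)) x y → toℕ p < toℕ q → WellFormed w →
    lookup w p ≡ x → lookup w q ≡ y →
    (∀ m → toℕ p < m → m < toℕ q → ∣ at w m ∣ ≢ ∣ x ∣ → ∣ at w m ∣ ≢ ∣ y ∣ → SameCostBetween x y y x (at w m)) →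
    localCost y x ≡ suc (localCost x y) →
    Covers (swapPos w p q) w
  coverBySwap w p q _ _ p<q wf refl refl between raise =
    coverByReflection w _ (transpWordAt p q p<q) (transpGenAt p q p<q) (sym (act-transpWordAt w p q p<q)) wf
      (sym (differByOne (ℓ w) _ _ _ (sym (ℓ-replace₂ w p q p<q wq wp cA cB cD)) raise))
    where
    wp wq : ℤ
    wp = lookup w p
    wq = lookup w q
    cA : ∀ e → EntryBefore w (toℕ p) e → SameCostLeft wp wq wq wp e
    cA e _ = NP.+-comm (pairCost e wp) (pairCost e wq)
    cB : ∀ e → EntryBetween w (toℕ p) (toℕ q) e → SameCostBetween wp wq wq wp e
    cB e (m , l₁ , l₂ , refl) = between m l₁ l₂
      (absDistinct wf m (NP.<-trans l₂ (toℕ<n q)) p (≢-sym (NP.<⇒≢ l₁)))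
      (absDistinct wf m (NP.<-trans l₂ (toℕ<n q)) q (NP.<⇒≢ l₂))
    cD : ∀ e → EntryAfter w (toℕ q) e → SameCostRight wp wq wq wp e
    cD e _ = NP.+-comm (pairCost wp e) (pairCost wq e)

  -- Cover criterion for the signed exchange of the entries x, y in positions
  -- p < q, which puts -y in position p and -x in position q: entries left
  -- of q must cost the same before and after (entries right of q always
  -- do), and the local cost must rise by one.
  coverBySignedSwap : ∀ {n} (w : Vec ℤ (suc n)) (p q : Fin (suc n)) x y → toℕ p < toℕ q → WellFormed w →
    lookup w p ≡ x → lookup w q ≡ y →
    (∀ m → m < toℕ p → ∣ at w m ∣ ≢ ∣ x ∣ → ∣ at w m ∣ ≢ ∣ y ∣ → SameCostLeft x y (- y) (- x) (at w m)) →
    (∀ m → toℕ p < m → m < toℕ q → ∣ at w m ∣ ≢ ∣ x ∣ → ∣ at w m ∣ ≢ ∣ y ∣ → SameCostBetween x y (- y) (- x) (at w m)) →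
    localCost (- y) (- x) ≡ suc (localCost x y) →
    Covers ((w [ p ]≔ - y) [ q ]≔ - x) w
  coverBySignedSwap w p q _ _ p<q wf refl refl before between raise =
    coverByReflection w _ (signedTranspWordAt p q p<q) (transpGenAt p q p<q) (sym (act-signedTranspWordAt w p q p<q)) wf
      (sym (differByOne (ℓ w) _ _ _ (sym (ℓ-replace₂ w p q p<q (- wq) (- wp) cA cB cD)) raise))
    where
    wp wq : ℤ
    wp = lookup w p
    wq = lookup w q
    cA : ∀ e → EntryBefore w (toℕ p) e → SameCostLeft wp wq (- wq) (- wp) e
    cA e (m , lt , refl) = before m lt
      (absDistinct wf m (NP.<-trans lt (toℕ<n p)) p (NP.<⇒≢ lt))
      (absDistinct wf m (NP.<-trans lt (toℕ<n p)) q (NP.<⇒≢ (NP.<-trans lt p<q)))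
    cB : ∀ e → EntryBetween w (toℕ p) (toℕ q) e → SameCostBetween wp wq (- wq) (- wp) e
    cB e (m , l₁ , l₂ , refl) = between m l₁ l₂
      (absDistinct wf m (NP.<-trans l₂ (toℕ<n q)) p (≢-sym (NP.<⇒≢ l₁)))
      (absDistinct wf m (NP.<-trans l₂ (toℕ<n q)) q (NP.<⇒≢ l₂))
    cD : ∀ e → EntryAfter w (toℕ q) e → SameCostRight wp wq (- wq) (- wp) e
    cD e _ = trans (NP.+-comm (pairCost wp e) (pairCost wq e))
      (cong₂ _+_ (pairCost-abs wq (- wq) e (sym (ZP.∣-i∣≡∣i∣ wq))) (pairCost-abs wp (- wp) e (sym (ZP.∣-i∣≡∣i∣ wp))))

  outsideOrBetween : ∀ z β α → β < α → z ≢ β → z ≢ α → (z < β) ⊎ ((β < z × z < α) ⊎ (α < z))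
  outsideOrBetween z β α lt nb na with NP.<-cmp z β
  ... | tri< l _ _ = inj₁ l
  ... | tri≈ _ e _ = ⊥-elim (nb e)
  ... | tri> _ _ g with NP.<-cmp z α
  ... | tri< l _ _ = inj₂ (inj₁ (g , l))
  ... | tri≈ _ e _ = ⊥-elim (na e)
  ... | tri> _ _ g′ = inj₂ (inj₂ g′)

  swapCost-between : ∀ β α e → β < α → ∣ e ∣ ≢ β → ∣ e ∣ ≢ α → (β < ∣ e ∣ → ∣ e ∣ < α → isNeg e ≡ 1) →
    SameCostBetween (+ β) (+ α) (+ α) (+ β) e
  swapCost-between β α e lt nb na neg with outsideOrBetween ∣ e ∣ β α lt nb na
  ... | inj₁ l = trans (cong₂ _+_ (pairCost-< (+ β) e l) (pairCost-≮ e (+ α) (NP.<-asym (NP.<-trans l lt))))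
                 (sym (cong₂ _+_ (pairCost-< (+ α) e (NP.<-trans l lt)) (pairCost-≮ e (+ β) (NP.<-asym l))))
  ... | inj₂ (inj₁ (l₁ , l₂)) =
        trans (cong₂ _+_ (trans (pairCost-≮ (+ β) e (NP.<-asym l₁)) (cong (λ z → z + z) (neg l₁ l₂))) (pairCost-≮ e (+ α) (NP.<-asym l₂)))
        (sym (cong₂ _+_ (pairCost-< (+ α) e l₂) (pairCost-< e (+ β) l₁)))
  ... | inj₂ (inj₂ g) = trans (cong₂ _+_ (pairCost-≮ (+ β) e (NP.<-asym (NP.<-trans lt g))) (pairCost-< e (+ α) g))
                 (sym (cong₂ _+_ (pairCost-≮ (+ α) e (NP.<-asym g)) (pairCost-< e (+ β) (NP.<-trans lt g))))

  signedSwapCost-before : ∀ α′ β′ e → suc β′ < suc α′ → ∣ e ∣ ≢ suc β′ → ∣ e ∣ ≢ suc α′ → ¬ (suc β′ < ∣ e ∣ × ∣ e ∣ < suc α′) →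
    SameCostLeft (+ suc α′) -[1+ β′ ] (+ suc β′) -[1+ α′ ] e
  signedSwapCost-before α′ β′ e lt nb na nm with outsideOrBetween ∣ e ∣ (suc β′) (suc α′) lt nb na
  ... | inj₁ l = trans (cong₂ _+_ (pairCost-≮ e (+ suc α′) (NP.<-asym (NP.<-trans l lt))) (pairCost-≮ e -[1+ β′ ] (NP.<-asym l)))
                 (sym (cong₂ _+_ (pairCost-≮ e (+ suc β′) (NP.<-asym l)) (pairCost-≮ e -[1+ α′ ] (NP.<-asym (NP.<-trans l lt)))))
  ... | inj₂ (inj₁ m) = ⊥-elim (nm m)
  ... | inj₂ (inj₂ g) = trans (cong₂ _+_ (pairCost-< e (+ suc α′) g) (pairCost-< e -[1+ β′ ] (NP.<-trans lt g)))
                 (sym (cong₂ _+_ (pairCost-< e (+ suc β′) (NP.<-trans lt g)) (pairCost-< e -[1+ α′ ] g)))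

  signedSwapCost-between : ∀ α′ β′ e → suc β′ < suc α′ → ∣ e ∣ ≢ suc β′ → ∣ e ∣ ≢ suc α′ → ¬ (suc β′ < ∣ e ∣ × ∣ e ∣ < suc α′) →
    SameCostBetween (+ suc α′) -[1+ β′ ] (+ suc β′) -[1+ α′ ] e
  signedSwapCost-between α′ β′ e lt nb na nm with outsideOrBetween ∣ e ∣ (suc β′) (suc α′) lt nb na
  ... | inj₁ l = trans (cong₂ _+_ (pairCost-< (+ suc α′) e (NP.<-trans l lt)) (pairCost-≮ e -[1+ β′ ] (NP.<-asym l)))
                 (sym (cong₂ _+_ (pairCost-< (+ suc β′) e l) (pairCost-≮ e -[1+ α′ ] (NP.<-asym (NP.<-trans l lt)))))
  ... | inj₂ (inj₁ m) = ⊥-elim (nm m)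
  ... | inj₂ (inj₂ g) = trans (cong₂ _+_ (pairCost-≮ (+ suc α′) e (NP.<-asym g)) (pairCost-< e -[1+ β′ ] (NP.<-trans lt g)))
                 (sym (cong₂ _+_ (pairCost-≮ (+ suc β′) e (NP.<-asym (NP.<-trans lt g))) (pairCost-< e -[1+ α′ ] g)))

  -- (1) Negating the entry 1 is a cover: every other entry exceeds it in
  -- absolute value, so costs the same against either sign.
  negateOneCovers : ∀ {n} (w : Vec ℤ (suc n)) (p : Fin (suc n)) → WellFormed w → lookup w p ≡ + 1 →
    Covers (w [ p ]≔ - (+ 1)) w
  negateOneCovers w p wf hp = coverByNegation w p (+ 1) wf hp before refl
    where
    before : ∀ m → m < toℕ p → ∣ at w m ∣ ≢ 1 → pairCost (at w m) (+ 1) ≡ pairCost (at w m) (- (+ 1))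
    before m lt ne = trans (pairCost-< (at w m) (+ 1) 1<e) (sym (pairCost-< (at w m) (- (+ 1)) 1<e))
      where
      1<e : 1 < ∣ at w m ∣
      1<e = NP.≤∧≢⇒< (proj₁ (inRange wf m (NP.<-trans lt (toℕ<n p)))) (λ e → ne (sym e))

  -- (2) The signed exchange (-(j+1), j+2) ↦ (-(j+2), j+1) is always a cover:
  -- no absolute value lies strictly between j+1 and j+2.
  adjacentSignedSwapCovers : ∀ {n} (w : Vec ℤ (suc n)) (p q : Fin (suc n)) j → toℕ p < toℕ q → WellFormed w →
    lookup w p ≡ -[1+ j ] → lookup w q ≡ + suc (suc j) →
    Covers ((w [ p ]≔ -[1+ suc j ]) [ q ]≔ + suc j) w
  adjacentSignedSwapCovers w p q j p<q wf hp hq =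
    coverBySignedSwap w p q -[1+ j ] (+ suc (suc j)) p<q wf hp hq before between
      (cong suc (trans (pairCost-< -[1+ suc j ] (+ suc j) (NP.n<1+n _))
                       (cong suc (sym (pairCost-≮ -[1+ j ] (+ suc (suc j)) (NP.<-asym (NP.n<1+n _)))))))
    where
    noneBetween : ∀ z → ¬ (suc j < z × z < suc (suc j))
    noneBetween z (l₁ , l₂) = NP.<⇒≱ l₁ (NP.≤-pred l₂)
    before : ∀ m → m < toℕ p → ∣ at w m ∣ ≢ suc j → ∣ at w m ∣ ≢ suc (suc j) →
      SameCostLeft -[1+ j ] (+ suc (suc j)) -[1+ suc j ] (+ suc j) (at w m)
    before m _ nx ny =
      trans (NP.+-comm (pairCost (at w m) -[1+ j ]) _)
      (trans (signedSwapCost-before (suc j) j (at w m) (NP.n<1+n _) nx ny (noneBetween _))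
             (NP.+-comm (pairCost (at w m) (+ suc j)) _))
    between : ∀ m → toℕ p < m → m < toℕ q → ∣ at w m ∣ ≢ suc j → ∣ at w m ∣ ≢ suc (suc j) →
      SameCostBetween -[1+ j ] (+ suc (suc j)) -[1+ suc j ] (+ suc j) (at w m)
    between m _ _ nx ny =
      swapCost-between (suc j) (suc (suc j)) (at w m) (NP.n<1+n _) nx ny (λ l₁ l₂ → ⊥-elim (noneBetween _ (l₁ , l₂)))

  exchangeCovers : ∀ {n} (w : Vec ℤ (suc n)) (p q : Fin (suc n)) β α → toℕ p < toℕ q → WellFormed w →
    lookup w p ≡ + β → lookup w q ≡ + α → β < α →
    (∀ m → toℕ p < m → m < toℕ q → β < ∣ at w m ∣ → ∣ at w m ∣ < α → isNeg (at w m) ≡ 1) →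
    Covers (swapPos w p q) w
  exchangeCovers w p q β α p<q wf hp hq β<α negBetween =
    coverBySwap w p q (+ β) (+ α) p<q wf hp hq
      (λ m l₁ l₂ nx ny → swapCost-between β α (at w m) β<α nx ny (negBetween m l₁ l₂))
      (trans (pairCost-< (+ α) (+ β) β<α) (cong suc (sym (pairCost-≮ (+ β) (+ α) (NP.<-asym β<α)))))

  signedExchangeCovers : ∀ {n} (w : Vec ℤ (suc n)) (p q : Fin (suc n)) β′ α′ → toℕ p < toℕ q → WellFormed w →
    lookup w p ≡ + suc α′ → lookup w q ≡ -[1+ β′ ] → suc β′ < suc α′ →
    (∀ m → m < toℕ q → ¬ (suc β′ < ∣ at w m ∣ × ∣ at w m ∣ < suc α′)) →
    Covers ((w [ p ]≔ + suc β′) [ q ]≔ -[1+ α′ ]) w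
  signedExchangeCovers w p q β′ α′ p<q wf hp hq β<α noneBefore =
    coverBySignedSwap w p q (+ suc α′) -[1+ β′ ] p<q wf hp hq
      (λ m lt nx ny → signedSwapCost-before α′ β′ (at w m) β<α ny nx (noneBefore m (NP.<-trans lt p<q)))
      (λ m _ lt nx ny → signedSwapCost-between α′ β′ (at w m) β<α ny nx (noneBefore m lt))
      (cong suc (trans (pairCost-≮ (+ suc β′) -[1+ α′ ] (NP.<-asym β<α))
                       (cong suc (sym (pairCost-< (+ suc α′) -[1+ β′ ] β<α)))))

  -- The moves on W^(k)_n.  The shape forces the signs of the entries
  -- involved, and the hypotheses on the values strictly between the moved
  -- ones become the conditions of the general forms.

  positionOf : ∀ {n} {w : Vec ℤ n} → WellFormed w → ∀ m (m′ : Fin n) → m < n → ∣ lookup w m′ ∣ ≡ ∣ at w m ∣ → toℕ m′ ≡ m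
  positionOf {w = w} wf m m′ lt e = absInjective wf (toℕ m′) m (toℕ<n m′) lt (trans (cong ∣_∣ (at-lookup w m′)) e)

  isNeg-negative : ∀ z → z ℤ.< + 0 → isNeg z ≡ 1
  isNeg-negative -[1+ _ ] _ = refl
  isNeg-negative (+ _) (+<+ ())

  lambdaVMove : ∀ {n} (w : Vec ℤ (suc n)) k r → WellFormed w → Shape k r w → ∀ (a : ℤ) (p q : Fin (suc n)) →
    IsLam k r p → lookup w p ≡ - (a ℤ.- + 1) → IsV k r q → lookup w q ≡ a →
    Covers ((w [ p ]≔ - a) [ q ]≔ (a ℤ.- + 1)) w
  lambdaVMove w k r wf sh (+ suc (suc j)) p q isLam hp isV hq =
    adjacentSignedSwapCovers w p q j (NP.<-≤-trans (proj₂ isLam) isV) wf hp hq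
  lambdaVMove w k r wf (_ , _ , _ , negL , _) (+ 0) p q isLam hp isV hq with subst (ℤ._< + 0) hp (negL p isLam)
  ... | +<+ ()
  lambdaVMove w k r wf (_ , _ , _ , negL , _) (+ 1) p q isLam hp isV hq with subst (ℤ._< + 0) hp (negL p isLam)
  ... | +<+ ()
  lambdaVMove w k r wf (_ , _ , _ , negL , _) -[1+ a ] p q isLam hp isV hq with subst (ℤ._< + 0) hp (negL p isLam)
  ... | +<+ ()

  -- Move (3): a u-entry b and a v-entry a > b, all values strictly between
  -- them being λ's, hence negative entries.
  uVMove : ∀ {n} (w : Vec ℤ (suc n)) k r → WellFormed w → Shape k r w → ∀ (a b : ℤ) (p q : Fin (suc n)) →
    IsU k r p → lookup w p ≡ b → IsV k r q → lookup w q ≡ a → b ℤ.< a →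
    (∀ (c : ℤ) → b ℤ.< c → c ℤ.< a → Σ[ m ∈ Fin (suc n) ] (IsLam k r m × lookup w m ≡ - c)) →
    Covers (swapPos w q p) w
  uVMove w k r wf (_ , _ , _ , negL , _) (+ α) (+ β) p q isU hp isV hq (+<+ β<α) lambdas =
    subst (λ z → Covers z w) (sym (swapPos-sym w p q))
      (exchangeCovers w p q β α (NP.<-≤-trans isU (NP.≤-trans (NP.m≤m+n k r) isV)) wf hp hq β<α negBetween)
    where
    negBetween : ∀ m → toℕ p < m → m < toℕ q → β < ∣ at w m ∣ → ∣ at w m ∣ < α → isNeg (at w m) ≡ 1
    negBetween m _ lt g l with lambdas (+ ∣ at w m ∣) (+<+ g) (+<+ l)
    ... | m′ , isLam , hm′ = trans (cong isNeg (trans (cong (at w) (sym m′≡m)) (at-lookup w m′))) (isNeg-negative _ (negL m′ isLam))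
      where
      m′≡m : toℕ m′ ≡ m
      m′≡m = positionOf wf m m′ (NP.<-trans lt (toℕ<n q)) (trans (cong ∣_∣ hm′) (ZP.∣-i∣≡∣i∣ (+ ∣ at w m ∣)))
  uVMove w k r wf (_ , posU , _) a -[1+ b ] p q isU hp isV hq lt lambdas with subst (+ 0 ℤ.<_) hp (posU p isU)
  ... | ()
  uVMove w k r wf sh -[1+ a ] (+ b) p q isU hp isV hq () lambdas

  -- Move (4): a u-entry a and a λ-entry -b with b < a, all values strictly
  -- between them being v's, hence standing right of the λ's.
  uLambdaMove : ∀ {n} (w : Vec ℤ (suc n)) k r → WellFormed w → Shape k r w → ∀ (a b : ℤ) (p q : Fin (suc n)) →
    IsU k r p → lookup w p ≡ a → IsLam k r q → lookup w q ≡ - b → b ℤ.< a →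
    (∀ (c : ℤ) → b ℤ.< c → c ℤ.< a → Σ[ m ∈ Fin (suc n) ] (IsV k r m × lookup w m ≡ c)) →
    Covers ((w [ p ]≔ b) [ q ]≔ - a) w
  uLambdaMove w k r wf sh (+ suc α′) (+ suc β′) p q isU hp isLam hq (+<+ β<α) vs =
    signedExchangeCovers w p q β′ α′ (NP.<-≤-trans isU (proj₁ isLam)) wf hp hq β<α noneBefore
    where
    noneBefore : ∀ m → m < toℕ q → ¬ (suc β′ < ∣ at w m ∣ × ∣ at w m ∣ < suc α′)
    noneBefore m lt (g , l) with vs (+ ∣ at w m ∣) (+<+ g) (+<+ l)
    ... | m′ , isV , hm′ = NP.<⇒≱ (NP.<-trans lt (proj₂ isLam)) (subst (k + r ≤_) m′≡m isV)
      where
      m′≡m : toℕ m′ ≡ m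
      m′≡m = positionOf wf m m′ (NP.<-trans lt (toℕ<n q)) (cong ∣_∣ hm′)
  uLambdaMove w k r wf (_ , _ , _ , negL , _) a (+ 0) p q isU hp isLam hq lt vs with subst (ℤ._< + 0) hq (negL q isLam)
  ... | +<+ ()
  uLambdaMove w k r wf (_ , _ , _ , negL , _) a -[1+ b ] p q isU hp isLam hq lt vs with subst (ℤ._< + 0) hq (negL q isLam)
  ... | +<+ ()
  uLambdaMove w k r wf (_ , posU , _) (+ 0) (+ suc b) p q isU hp isLam hq lt vs with subst (+ 0 ℤ.<_) hp (posU p isU)
  ... | +<+ ()
  uLambdaMove w k r wf (_ , posU , _) -[1+ a ] (+ suc b) p q isU hp isLam hq lt vs with subst (+ 0 ℤ.<_) hp (posU p isU)
  ... | ()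

open Development using (WellFormed; negateOneCovers; lambdaVMove; uVMove; uLambdaMove; signedPerm⇒wellFormed)

open import Data.Nat using (ℕ; _≤_; suc)
open import Data.Fin using (Fin)
open import Data.Integer using (ℤ; +_; -_; _-_; _<_)
open import Data.Vec using (lookup; _[_]≔_)
open import Data.Product using (Σ-syntax; _×_; _,_)
open import Relation.Binary.PropositionalEquality using (_≡_)

-- Membership in W_n makes w' well formed; each part is then one of the
-- moves above (move (1) needs no shape information at all).
mainTheorem4 :
    ∀ (n : ℕ) → 1 ≤ n → ∀ (k : ℕ) → k ≤ n →
    ∀ (w' : OneLine n) (r : ℕ) → InWk n k r w' →
    -- (1) 1 is a v  ⇒  replacing 1 by 1̄ gives a cover
    (∀ (p : Fin n) → IsV k r p → lookup w' p ≡ + 1 →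
       Covers (w' [ p ]≔ - (+ 1)) w')
    ×
    -- (2) a-1 is a λ (entry (a-1)̄) and a is a v
    (∀ (a : ℤ) (p q : Fin n) →
       IsLam k r p → lookup w' p ≡ - (a - + 1) →
       IsV k r q → lookup w' q ≡ a →
       Covers ((w' [ p ]≔ - a) [ q ]≔ (a - + 1)) w')
    ×
    -- (3) b a u, a a v, a > b, all of b+1..a-1 among the λ's
    (∀ (a b : ℤ) (p q : Fin n) →
       IsU k r p → lookup w' p ≡ b →
       IsV k r q → lookup w' q ≡ a →
       b < a →
       (∀ (c : ℤ) → b < c → c < a →
          Σ[ m ∈ Fin n ] (IsLam k r m × lookup w' m ≡ - c)) →
       Covers (swapPos w' q p) w')
    ×
    -- (4) a a u, b a λ (entry b̄), a > b, all of b+1..a-1 among the v's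
    (∀ (a b : ℤ) (p q : Fin n) →
       IsU k r p → lookup w' p ≡ a →
       IsLam k r q → lookup w' q ≡ - b →
       b < a →
       (∀ (c : ℤ) → b < c → c < a →
          Σ[ m ∈ Fin n ] (IsV k r m × lookup w' m ≡ c)) →
       Covers ((w' [ p ]≔ b) [ q ]≔ - a) w')
mainTheorem4 (suc n) _ k _ w' r (perm , shape) =
  (λ p _ hp → negateOneCovers w' p wf hp) ,
  lambdaVMove w' k r wf shape ,
  uVMove w' k r wf shape ,
  uLambdaMove w' k r wf shape
  where
  wf : WellFormed w'
  wf = signedPerm⇒wellFormed w' perm
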